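{- We have \[\sum_{n\geq 0}\overline{R^\ast_6}(3n+2)q^n\equiv 4f_6^3\pmod 8,\] as formal power series in $q$ with integer coefficients.
   Context: For a positive integer $\ell$, $\overline{R^\ast_\ell}(n)$ denotes the number of overpartitions of $n$ in which the non-overlined parts are not divisible by $\ell$ (no restriction on overlined parts); equivalently $\sum_{n\ge0}\overline{R^\ast_\ell}(n)q^n=\prod_{n\ge1}\frac{(1-q^{\ell n})(1+q^n)}{1-q^n}$. For positive integers $k$, $f_k:=\prod_{i\geq1}(1-q^{ik})$. An overpartition of $n$ is a partition of $n$ in which the first occurrence of each distinct part size may optionally be overlined. -}

module Defs where

open import Data.Nat as ℕ using (ℕ; zero; suc; _∸_; _≟_)
open import Data.Nat.Divisibility using (_∣?_)
open import Data.Integer using (ℤ; +_; -_; _+_; _*_)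
open import Data.List using (List; upTo; map; foldr)
open import Relation.Nullary using (yes; no)

Series : Set
Series = ℕ → ℤ

_⊛_ : Series → Series → Series
(a ⊛ b) n = foldr _+_ (+ 0) (map (λ i → a i * b (n ∸ i)) (upTo (suc n)))
infixl 7 _⊛_

one : Series
one zero    = + 1
one (suc _) = + 0

-- 1 - q^d   (used with d ≥ 1)
oneMinusQ : ℕ → Series
oneMinusQ d zero = + 1
oneMinusQ d (suc m) with suc m ≟ d
... | yes _ = - (+ 1)
... | no  _ = + 0

-- 1 + q^d   (used with d ≥ 1)
onePlusQ : ℕ → Series
onePlusQ d zero = + 1
onePlusQ d (suc m) with suc m ≟ d
... | yes _ = + 1
... | no  _ = + 0

-- 1/(1 - q^d) = Σ_j q^{dj}   (used with d ≥ 1)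
geomQ : ℕ → Series
geomQ d m with d ∣? m
... | yes _ = + 1
... | no  _ = + 0

prodTo : ℕ → (ℕ → Series) → Series
prodTo zero    F = one
prodTo (suc N) F = prodTo N F ⊛ F (suc N)

-- f_k = ∏_{i≥1} (1 - q^{ik}); for k ≥ 1 the coefficient of q^n only
-- involves the factors with i ≤ n, so truncating at n is exact.
f : ℕ → Series
f k n = prodTo n (λ i → oneMinusQ (i ℕ.* k)) n

-- Σ R̄*_ℓ(n) q^n = ∏_{i≥1} (1 - q^{ℓi})(1 + q^i)/(1 - q^i);
-- the coefficient of q^n only involves the factors with i ≤ n (ℓ ≥ 1).
Rbar* : ℕ → ℕ → ℤ
Rbar* ℓ n = prodTo n (λ i → oneMinusQ (ℓ ℕ.* i) ⊛ onePlusQ i ⊛ geomQ i) n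

f³ : ℕ → Series
f³ k n = (f k ⊛ f k ⊛ f k) n

-- R = Σ R̄*₆(n) qⁿ = f₆ f₂ / f₁², and by Gauss f₁² / f₂ = φ(−q) = 1 + 2S with S = Σ_{s≥1} (−1)ˢ q^(s²),
-- so R · (1 + 2S) = f₆ and R ≡ f₆ (1 − 2S + 4S²) (mod 8), where 4S² ≡ 4 Σ_{s≥1} q^(2s²) (mod 8).
-- Squares are 0 or 1 mod 3 and f₆ only has exponents divisible by 6, so at q^(3n+2) only the last term
-- survives, through the s with 3 ∤ s; it contributes 4 times the coefficient of qⁿ in f₂ T, where
-- T = Σ_{t ∈ ℤ} q^(2t(3t+2)). Jacobi's triple product gives T = ∏ (1 + q^(12i+2))(1 + q^(12i+10))(1 − q^(12i+12)),
-- and modulo 2 this becomes f₂ T ≡ f₆³.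
--
-- Every identity is proved as a congruence in degrees ≤ N modulo m, which lets infinite products be
-- replaced by finite ones; the triple product itself comes from the q-binomial theorem, whose Gaussian
-- binomials [2K, K ± s] tend to 1/(Q; Q)_∞.

module Submission where

open import Defs
open import Data.Nat as ℕ using (ℕ; zero; suc; _∸_; _≤_; _<_; z≤n; s≤s)
import Data.Nat.Properties as ℕP
import Data.Nat.Tactic.RingSolver as NS
import Data.Nat.Divisibility as ND
open import Data.Integer as ℤ using (ℤ; +_; -_)
import Data.Integer.Properties as ℤP
open import Data.Integer.Tactic.RingSolver using (solve-∀)
open import Data.List using (map; foldr; applyUpTo)
open import Data.Maybe using (Maybe; just; nothing)
open import Data.Product using (Σ; _,_; proj₁; proj₂; _×_)
open import Data.Sum using (_⊎_; inj₁; inj₂)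
open import Data.Empty using (⊥-elim)
open import Function using (_∘_)
open import Level using (0ℓ)
open import Relation.Nullary using (¬_; yes; no)
open import Relation.Binary.PropositionalEquality
  using (_≡_; refl; sym; trans; cong; cong₂; subst; _≗_; module ≡-Reasoning)
open import Algebra.Bundles using (CommutativeRing; RawRing)
import Algebra.Structures as AS
open import Algebra.Solver.Ring.AlmostCommutativeRing
  using (AlmostCommutativeRing; _-Raw-AlmostCommutative⟶_; fromCommutativeRing)


module IntegerSums where
  open import Data.Integer using (_+_; _*_; _-_)

  sumℤ : ℕ → (ℕ → ℤ) → ℤ
  sumℤ zero g = + 0
  sumℤ (suc n) g = g 0 + sumℤ n (λ i → g (suc i))

  foldr-map≡sumℤ : ∀ n (f : ℕ → ℕ) (h : ℕ → ℤ) →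
    foldr _+_ (+ 0) (map h (applyUpTo f n)) ≡ sumℤ n (λ i → h (f i))
  foldr-map≡sumℤ zero f h = refl
  foldr-map≡sumℤ (suc n) f h = cong (λ x → h (f 0) + x) (foldr-map≡sumℤ n (f ∘ suc) h)

  ⊛≡sumℤ : ∀ a b n → (a ⊛ b) n ≡ sumℤ (suc n) (λ i → a i * b (n ∸ i))
  ⊛≡sumℤ a b n = foldr-map≡sumℤ (suc n) (λ i → i) (λ i → a i * b (n ∸ i))

  sumℤ-cong : ∀ n {g h : ℕ → ℤ} → (∀ i → i < n → g i ≡ h i) → sumℤ n g ≡ sumℤ n h
  sumℤ-cong zero e = refl
  sumℤ-cong (suc n) e = cong₂ _+_ (e 0 (s≤s z≤n)) (sumℤ-cong n (λ i i<n → e (suc i) (s≤s i<n)))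

  sumℤ-+ : ∀ n (g h : ℕ → ℤ) → sumℤ n (λ i → g i + h i) ≡ sumℤ n g + sumℤ n h
  sumℤ-+ zero g h = refl
  sumℤ-+ (suc n) g h rewrite sumℤ-+ n (g ∘ suc) (h ∘ suc) = interchange (g 0) (h 0) _ _
    where interchange : ∀ a b c d → (a + b) + (c + d) ≡ (a + c) + (b + d)
          interchange = solve-∀

  sumℤ-neg : ∀ n (g : ℕ → ℤ) → sumℤ n (λ i → - g i) ≡ - sumℤ n g
  sumℤ-neg zero g = refl
  sumℤ-neg (suc n) g rewrite sumℤ-neg n (g ∘ suc) = sym (ℤP.neg-distrib-+ (g 0) (sumℤ n (g ∘ suc)))

  sumℤ-- : ∀ n (g h : ℕ → ℤ) → sumℤ n g - sumℤ n h ≡ sumℤ n (λ i → g i - h i)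
  sumℤ-- n g h = sym (trans (sumℤ-+ n g (λ i → - h i)) (cong (λ t → sumℤ n g + t) (sumℤ-neg n h)))

  sumℤ-*ˡ : ∀ n c (g : ℕ → ℤ) → sumℤ n (λ i → c * g i) ≡ c * sumℤ n g
  sumℤ-*ˡ zero c g = sym (ℤP.*-zeroʳ c)
  sumℤ-*ˡ (suc n) c g rewrite sumℤ-*ˡ n c (g ∘ suc) = sym (ℤP.*-distribˡ-+ c (g 0) _)

  sumℤ-*ʳ : ∀ n c (g : ℕ → ℤ) → sumℤ n (λ i → g i * c) ≡ sumℤ n g * c
  sumℤ-*ʳ n c g = trans (sumℤ-cong n (λ i _ → ℤP.*-comm (g i) c)) (trans (sumℤ-*ˡ n c g) (ℤP.*-comm c _))

  sumℤ-snoc : ∀ n (g : ℕ → ℤ) → sumℤ (suc n) g ≡ sumℤ n g + g n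
  sumℤ-snoc zero g = ℤP.+-comm (g 0) (+ 0)
  sumℤ-snoc (suc n) g rewrite sumℤ-snoc n (g ∘ suc) = sym (ℤP.+-assoc (g 0) _ _)

  sumℤ-zero : ∀ n (g : ℕ → ℤ) → (∀ i → i < n → g i ≡ + 0) → sumℤ n g ≡ + 0
  sumℤ-zero n g e = trans (sumℤ-cong n e) (z n)
    where z : ∀ n → sumℤ n (λ _ → + 0) ≡ + 0
          z zero = refl
          z (suc n) = trans (ℤP.+-identityˡ _) (z n)

  sumℤ-reverse : ∀ n (g : ℕ → ℤ) → sumℤ n g ≡ sumℤ n (λ i → g (n ∸ suc i))
  sumℤ-reverse zero g = refl
  sumℤ-reverse (suc n) g = begin
      g 0 + sumℤ n (g ∘ suc)
    ≡⟨ cong (λ x → g 0 + x) (sumℤ-reverse n (g ∘ suc)) ⟩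
      g 0 + sumℤ n (λ i → g (suc (n ∸ suc i)))
    ≡⟨ ℤP.+-comm (g 0) _ ⟩
      sumℤ n (λ i → g (suc (n ∸ suc i))) + g 0
    ≡⟨ cong₂ _+_ (sumℤ-cong n (λ i i<n → cong g (sym (ℕP.+-∸-assoc 1 i<n)))) (cong g (sym (ℕP.n∸n≡0 n))) ⟩
      sumℤ n (λ i → g (n ∸ i)) + g (n ∸ n)
    ≡⟨ sym (sumℤ-snoc n (λ i → g (n ∸ i))) ⟩
      sumℤ (suc n) (λ i → g (n ∸ i))
    ∎ where open ≡-Reasoning

  sumℤ-single : ∀ n e (g : ℕ → ℤ) → e < n → (∀ i → i < n → ¬ (i ≡ e) → g i ≡ + 0) → sumℤ n g ≡ g e
  sumℤ-single (suc n) e g (s≤s e≤n) z with ℕP.m≤n⇒m<n∨m≡n e≤n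
  ... | inj₁ e<n = begin
      sumℤ (suc n) g ≡⟨ sumℤ-snoc n g ⟩
      sumℤ n g + g n ≡⟨ cong₂ _+_ (sumℤ-single n e g e<n (λ i i<n → z i (ℕP.m≤n⇒m≤1+n i<n)))
                                (z n ℕP.≤-refl (λ n≡e → ℕP.<-irrefl (sym n≡e) e<n)) ⟩
      g e + + 0 ≡⟨ ℤP.+-identityʳ _ ⟩
      g e ∎ where open ≡-Reasoning
  ... | inj₂ refl = begin
      sumℤ (suc n) g ≡⟨ sumℤ-snoc n g ⟩
      sumℤ n g + g n ≡⟨ cong (_+ g n) (sumℤ-zero n g (λ i i<n → z i (ℕP.m≤n⇒m≤1+n i<n) (λ i≡n → ℕP.<-irrefl i≡n i<n))) ⟩
      + 0 + g n ≡⟨ ℤP.+-identityˡ _ ⟩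
      g n ∎ where open ≡-Reasoning

  sumℤ-triangle : ∀ n (F : ℕ → ℕ → ℤ) →
    sumℤ n (λ i → sumℤ (suc i) (F i)) ≡ sumℤ n (λ j → sumℤ (n ∸ j) (λ k → F (j ℕ.+ k) j))
  sumℤ-triangle zero F = refl
  sumℤ-triangle (suc n) F = begin
      sumℤ (suc n) (λ i → sumℤ (suc i) (F i))
    ≡⟨ sumℤ-snoc n (λ i → sumℤ (suc i) (F i)) ⟩
      sumℤ n (λ i → sumℤ (suc i) (F i)) + sumℤ (suc n) (F n)
    ≡⟨ cong (_+ sumℤ (suc n) (F n)) (sumℤ-triangle n F) ⟩
      sumℤ n (λ j → sumℤ (n ∸ j) (λ k → F (j ℕ.+ k) j)) + sumℤ (suc n) (F n)
    ≡⟨ cong (_+ sumℤ (suc n) (F n)) (sym (trans (sumℤ-snoc n (λ j → sumℤ (n ∸ j) (λ k → F (j ℕ.+ k) j)))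
          (trans (cong (λ t → sumℤ n (λ j → sumℤ (n ∸ j) (λ k → F (j ℕ.+ k) j)) + sumℤ t (λ k → F (n ℕ.+ k) n)) (ℕP.n∸n≡0 n))
                 (ℤP.+-identityʳ (sumℤ n (λ j → sumℤ (n ∸ j) (λ k → F (j ℕ.+ k) j))))))) ⟩
      sumℤ (suc n) (λ j → sumℤ (n ∸ j) (λ k → F (j ℕ.+ k) j)) + sumℤ (suc n) (F n)
    ≡⟨ sym (sumℤ-+ (suc n) (λ j → sumℤ (n ∸ j) (λ k → F (j ℕ.+ k) j)) (F n)) ⟩
      sumℤ (suc n) (λ j → sumℤ (n ∸ j) (λ k → F (j ℕ.+ k) j) + F n j)
    ≡⟨ sumℤ-cong (suc n) (λ j j<sn → let j≤n = ℕP.≤-pred j<sn in sym (trans (cong (λ t → sumℤ t (λ k → F (j ℕ.+ k) j)) (ℕP.+-∸-assoc 1 j≤n))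
          (trans (sumℤ-snoc (n ∸ j) (λ k → F (j ℕ.+ k) j)) (cong (λ t → sumℤ (n ∸ j) (λ k → F (j ℕ.+ k) j) + F t j) (ℕP.m+[n∸m]≡n j≤n))))) ⟩
      sumℤ (suc n) (λ j → sumℤ (suc n ∸ j) (λ k → F (j ℕ.+ k) j))
    ∎ where open ≡-Reasoning

open IntegerSums

module PowerSeries where
  open import Data.Integer using (_+_; _*_; _-_)

  scalar : ℤ → Series
  scalar c zero = c
  scalar c (suc _) = + 0

  𝟘 : Series
  𝟘 = scalar (+ 0)

  𝟘-coeff : ∀ i → 𝟘 i ≡ + 0
  𝟘-coeff zero = refl
  𝟘-coeff (suc i) = refl

  ⊛-comm : ∀ a b → a ⊛ b ≗ b ⊛ a
  ⊛-comm a b n = begin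
      (a ⊛ b) n
    ≡⟨ ⊛≡sumℤ a b n ⟩
      sumℤ (suc n) (λ i → a i * b (n ∸ i))
    ≡⟨ sumℤ-reverse (suc n) (λ i → a i * b (n ∸ i)) ⟩
      sumℤ (suc n) (λ i → a (n ∸ i) * b (n ∸ (n ∸ i)))
    ≡⟨ sumℤ-cong (suc n) (λ i i<sn → let i≤n = ℕP.≤-pred i<sn in trans (cong (λ t → a (n ∸ i) * b t) (ℕP.m∸[m∸n]≡n i≤n)) (ℤP.*-comm (a (n ∸ i)) (b i))) ⟩
      sumℤ (suc n) (λ i → b i * a (n ∸ i))
    ≡⟨ sym (⊛≡sumℤ b a n) ⟩
      (b ⊛ a) n
    ∎ where open ≡-Reasoning

  ⊛-assoc : ∀ a b c → (a ⊛ b) ⊛ c ≗ a ⊛ (b ⊛ c)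
  ⊛-assoc a b c n = begin
      ((a ⊛ b) ⊛ c) n
    ≡⟨ ⊛≡sumℤ (a ⊛ b) c n ⟩
      sumℤ (suc n) (λ i → (a ⊛ b) i * c (n ∸ i))
    ≡⟨ sumℤ-cong (suc n) (λ i _ → trans (cong (_* c (n ∸ i)) (⊛≡sumℤ a b i)) (sym (sumℤ-*ʳ (suc i) (c (n ∸ i)) (λ j → a j * b (i ∸ j))))) ⟩
      sumℤ (suc n) (λ i → sumℤ (suc i) (λ j → a j * b (i ∸ j) * c (n ∸ i)))
    ≡⟨ sumℤ-triangle (suc n) (λ i j → a j * b (i ∸ j) * c (n ∸ i)) ⟩
      sumℤ (suc n) (λ j → sumℤ (suc n ∸ j) (λ k → a j * b ((j ℕ.+ k) ∸ j) * c (n ∸ (j ℕ.+ k))))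
    ≡⟨ sumℤ-cong (suc n) (λ j j<sn → let j≤n = ℕP.≤-pred j<sn in trans (cong (λ t → sumℤ t (λ k → a j * b ((j ℕ.+ k) ∸ j) * c (n ∸ (j ℕ.+ k)))) (ℕP.+-∸-assoc 1 j≤n))
          (trans (sumℤ-cong (suc (n ∸ j)) (λ k _ → trans (cong₂ (λ u v → a j * b u * c v) (ℕP.m+n∸m≡n j k) (sym (ℕP.∸-+-assoc n j k)))
                                                          (ℤP.*-assoc (a j) (b k) (c ((n ∸ j) ∸ k)))))
           (trans (sumℤ-*ˡ (suc (n ∸ j)) (a j) (λ k → b k * c ((n ∸ j) ∸ k))) (cong (a j *_) (sym (⊛≡sumℤ b c (n ∸ j))))))) ⟩
      sumℤ (suc n) (λ j → a j * (b ⊛ c) (n ∸ j))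
    ≡⟨ sym (⊛≡sumℤ a (b ⊛ c) n) ⟩
      (a ⊛ (b ⊛ c)) n
    ∎ where open ≡-Reasoning

  ⊛-distribˡ : ∀ a b c → a ⊛ (λ i → b i + c i) ≗ (λ i → (a ⊛ b) i + (a ⊛ c) i)
  ⊛-distribˡ a b c n = begin
      (a ⊛ (λ i → b i + c i)) n
    ≡⟨ ⊛≡sumℤ a (λ i → b i + c i) n ⟩
      sumℤ (suc n) (λ i → a i * (b (n ∸ i) + c (n ∸ i)))
    ≡⟨ sumℤ-cong (suc n) (λ i _ → ℤP.*-distribˡ-+ (a i) (b (n ∸ i)) (c (n ∸ i))) ⟩
      sumℤ (suc n) (λ i → a i * b (n ∸ i) + a i * c (n ∸ i))
    ≡⟨ sumℤ-+ (suc n) (λ i → a i * b (n ∸ i)) (λ i → a i * c (n ∸ i)) ⟩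
      sumℤ (suc n) (λ i → a i * b (n ∸ i)) + sumℤ (suc n) (λ i → a i * c (n ∸ i))
    ≡⟨ sym (cong₂ _+_ (⊛≡sumℤ a b n) (⊛≡sumℤ a c n)) ⟩
      (a ⊛ b) n + (a ⊛ c) n
    ∎ where open ≡-Reasoning

  one-⊛-identity : ∀ a → one ⊛ a ≗ a
  one-⊛-identity a n = begin
      (one ⊛ a) n
    ≡⟨ ⊛≡sumℤ one a n ⟩
      + 1 * a n + sumℤ n (λ i → + 0 * a (n ∸ suc i))
    ≡⟨ cong₂ _+_ (ℤP.*-identityˡ (a n)) (sumℤ-zero n _ (λ i _ → refl)) ⟩
      a n + + 0
    ≡⟨ ℤP.+-identityʳ _ ⟩
      a n
    ∎ where open ≡-Reasoning

  ⊛-constantTerm : ∀ a b → (a ⊛ b) 0 ≡ a 0 * b 0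
  ⊛-constantTerm a b = ℤP.+-identityʳ _

  -- Opaque, so that products of series stay folded during unification and normalisation.
  opaque
    _·_ : Series → Series → Series
    _·_ = _⊛_

    _⊕_ : Series → Series → Series
    (a ⊕ b) i = a i + b i

    ⊖_ : Series → Series
    (⊖ a) i = - a i

    ·-coeff : ∀ a b i → (a · b) i ≡ (a ⊛ b) i
    ·-coeff a b i = refl

    ⊕-coeff : ∀ a b i → (a ⊕ b) i ≡ a i + b i
    ⊕-coeff a b i = refl

    ⊖-coeff : ∀ a i → (⊖ a) i ≡ - a i
    ⊖-coeff a i = refl

  infixl 7 _·_
  infixl 6 _⊕_
  infix 8 ⊖_

  ·≡sumℤ : ∀ a b n → (a · b) n ≡ sumℤ (suc n) (λ i → a i * b (n ∸ i))
  ·≡sumℤ a b n = trans (·-coeff a b n) (⊛≡sumℤ a b n)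

  ·-comm : ∀ a b → a · b ≗ b · a
  ·-comm a b i = trans (·-coeff a b i) (trans (⊛-comm a b i) (sym (·-coeff b a i)))

  ⊛-cong-≗ : ∀ a a' b b' → a ≗ a' → b ≗ b' → a ⊛ b ≗ a' ⊛ b'
  ⊛-cong-≗ a a' b b' e f n = trans (⊛≡sumℤ a b n) (trans (sumℤ-cong (suc n) (λ i _ → cong₂ _*_ (e i) (f (n ∸ i)))) (sym (⊛≡sumℤ a' b' n)))

  ·-cong-≗ : ∀ {a a' b b'} → a ≗ a' → b ≗ b' → a · b ≗ a' · b'
  ·-cong-≗ {a} {a'} {b} {b'} e f n = trans (·-coeff a b n) (trans (⊛-cong-≗ a a' b b' e f n) (sym (·-coeff a' b' n)))

  ·-assoc : ∀ a b c → (a · b) · c ≗ a · (b · c)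
  ·-assoc a b c i = trans (·-coeff (a · b) c i) (trans (⊛-cong-≗ (a · b) (a ⊛ b) c c (·-coeff a b) (λ _ → refl) i)
     (trans (⊛-assoc a b c i) (trans (⊛-cong-≗ a a (b ⊛ c) (b · c) (λ _ → refl) (λ j → sym (·-coeff b c j)) i) (sym (·-coeff a (b · c) i)))))

  ·-distribˡ : ∀ a b c → a · (b ⊕ c) ≗ (a · b) ⊕ (a · c)
  ·-distribˡ a b c i = trans (·-coeff a (b ⊕ c) i) (trans (⊛-cong-≗ a a (b ⊕ c) (λ i → b i + c i) (λ _ → refl) (⊕-coeff b c) i)
     (trans (⊛-distribˡ a b c i) (trans (cong₂ _+_ (sym (·-coeff a b i)) (sym (·-coeff a c i))) (sym (⊕-coeff (a · b) (a · c) i)))))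

  one-·-identity : ∀ a → one · a ≗ a
  one-·-identity a i = trans (·-coeff one a i) (one-⊛-identity a i)

  ·-constantTerm : ∀ a b → (a · b) 0 ≡ a 0 * b 0
  ·-constantTerm a b = trans (·-coeff a b 0) (⊛-constantTerm a b)

  scalar·-coeff : ∀ c X i → (scalar c · X) i ≡ c * X i
  scalar·-coeff c X i = trans (·≡sumℤ (scalar c) X i) (trans (cong (λ t → c * X i + t) (sumℤ-zero i _ (λ j _ → refl))) (ℤP.+-identityʳ _))

  𝟙 : Series
  𝟙 = scalar (+ 1)

  𝟙≗one : 𝟙 ≗ one
  𝟙≗one zero = refl
  𝟙≗one (suc i) = refl

  ⊕-assoc : ∀ a b c → (a ⊕ b) ⊕ c ≗ a ⊕ (b ⊕ c)
  ⊕-assoc a b c i = trans (⊕-coeff (a ⊕ b) c i) (trans (cong (_+ c i) (⊕-coeff a b i)) (trans (ℤP.+-assoc (a i) (b i) (c i))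
     (sym (trans (⊕-coeff a (b ⊕ c) i) (cong (λ t → a i + t) (⊕-coeff b c i))))))

  ⊕-comm : ∀ a b → a ⊕ b ≗ b ⊕ a
  ⊕-comm a b i = trans (⊕-coeff a b i) (trans (ℤP.+-comm (a i) (b i)) (sym (⊕-coeff b a i)))

  ⊕-identityˡ : ∀ a → 𝟘 ⊕ a ≗ a
  ⊕-identityˡ a i = trans (⊕-coeff 𝟘 a i) (trans (cong (_+ a i) (𝟘-coeff i)) (ℤP.+-identityˡ (a i)))

  ⊕-identityʳ : ∀ a → a ⊕ 𝟘 ≗ a
  ⊕-identityʳ a i = trans (⊕-comm a 𝟘 i) (⊕-identityˡ a i)

  ⊖-inverseˡ : ∀ a → ⊖ a ⊕ a ≗ 𝟘
  ⊖-inverseˡ a i = trans (⊕-coeff (⊖ a) a i) (trans (cong (_+ a i) (⊖-coeff a i)) (trans (ℤP.+-inverseˡ (a i)) (sym (𝟘-coeff i))))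

  ⊖-inverseʳ : ∀ a → a ⊕ ⊖ a ≗ 𝟘
  ⊖-inverseʳ a i = trans (⊕-comm a (⊖ a) i) (⊖-inverseˡ a i)

  ·-distribʳ : ∀ a b c → (b ⊕ c) · a ≗ (b · a) ⊕ (c · a)
  ·-distribʳ a b c i = trans (·-comm (b ⊕ c) a i) (trans (·-distribˡ a b c i) (trans (⊕-coeff (a · b) (a · c) i)
     (trans (cong₂ _+_ (·-comm a b i) (·-comm a c i)) (sym (⊕-coeff (b · a) (c · a) i)))))

  ·-identityˡ : ∀ a → 𝟙 · a ≗ a
  ·-identityˡ a i = trans (·-cong-≗ 𝟙≗one (λ _ → refl) i) (one-·-identity a i)

  ·-identityʳ : ∀ a → a · 𝟙 ≗ a
  ·-identityʳ a i = trans (·-comm a 𝟙 i) (·-identityˡ a i)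

  scalar-* : ∀ a b → scalar (a * b) ≗ scalar a · scalar b
  scalar-* a b zero = sym (·-constantTerm (scalar a) (scalar b))
  scalar-* a b (suc n) = sym (trans (·≡sumℤ (scalar a) (scalar b) (suc n))
     (cong₂ _+_ (ℤP.*-zeroʳ a) (sumℤ-zero (suc n) _ (λ i _ → refl))))

  scalar-+ : ∀ a b → scalar (a + b) ≗ scalar a ⊕ scalar b
  scalar-+ a b zero = sym (⊕-coeff (scalar a) (scalar b) zero)
  scalar-+ a b (suc n) = sym (⊕-coeff (scalar a) (scalar b) (suc n))

  scalar-neg : ∀ a → scalar (- a) ≗ ⊖ scalar a
  scalar-neg a zero = sym (⊖-coeff (scalar a) zero)
  scalar-neg a (suc n) = sym (⊖-coeff (scalar a) (suc n))

open PowerSeries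

module TruncatedCongruence where
  open import Data.Integer using (_+_; _*_; _-_)
  open import Data.Integer.Divisibility.Signed using (_∣_; divides; ∣m∣n⇒∣m+n; ∣m⇒∣-m; ∣n⇒∣m*n; ∣m⇒∣m*n)

  ∣-respʳ-≡ : ∀ {m x y} → x ≡ y → m ∣ x → m ∣ y
  ∣-respʳ-≡ refl d = d

  ∣-sumℤ : ∀ {m} n (g : ℕ → ℤ) → (∀ i → i < n → m ∣ g i) → m ∣ sumℤ n g
  ∣-sumℤ zero g d = divides (+ 0) refl
  ∣-sumℤ (suc n) g d = ∣m∣n⇒∣m+n (d 0 (s≤s z≤n)) (∣-sumℤ n (g ∘ suc) (λ i i<n → d (suc i) (s≤s i<n)))

  record CongUpTo (N : ℕ) (m : ℤ) (A B : Series) : Set where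
    constructor congUpTo
    field coeffCong : ∀ i → i ≤ N → m ∣ (A i - B i)
  open CongUpTo public

  ≗⇒≈ : ∀ {N m A B} → A ≗ B → CongUpTo N m A B
  ≗⇒≈ {A = A} e = congUpTo λ i _ →
    ∣-respʳ-≡ (sym (trans (cong (λ t → A i - t) (sym (e i))) (ℤP.+-inverseʳ (A i)))) (divides (+ 0) refl)

  CongUpTo-refl : ∀ {N m A} → CongUpTo N m A A
  CongUpTo-refl = ≗⇒≈ (λ _ → refl)

  CongUpTo-sym : ∀ {N m A B} → CongUpTo N m A B → CongUpTo N m B A
  CongUpTo-sym {A = A} {B} r = congUpTo λ i i≤N → ∣-respʳ-≡ (negate (A i) (B i)) (∣m⇒∣-m (coeffCong r i i≤N))
    where negate : ∀ a b → - (a - b) ≡ b - a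
          negate = solve-∀

  CongUpTo-trans : ∀ {N m A B C} → CongUpTo N m A B → CongUpTo N m B C → CongUpTo N m A C
  CongUpTo-trans {A = A} {B} {C} r s = congUpTo λ i i≤N →
    ∣-respʳ-≡ (telescope (A i) (B i) (C i)) (∣m∣n⇒∣m+n (coeffCong r i i≤N) (coeffCong s i i≤N))
    where telescope : ∀ a b c → (a - b) + (b - c) ≡ a - c
          telescope = solve-∀

  CongUpTo-mono : ∀ {N N' m A B} → N' ≤ N → CongUpTo N m A B → CongUpTo N' m A B
  CongUpTo-mono N'≤N r = congUpTo λ i i≤N' → coeffCong r i (ℕP.≤-trans i≤N' N'≤N)

  ⊕-cong : ∀ {N m A A' B B'} → CongUpTo N m A A' → CongUpTo N m B B' → CongUpTo N m (A ⊕ B) (A' ⊕ B')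
  ⊕-cong {A = A} {A'} {B} {B'} r s = congUpTo λ i i≤N →
    ∣-respʳ-≡ (sym (trans (cong₂ _-_ (⊕-coeff A B i) (⊕-coeff A' B' i)) (regroup (A i) (B i) (A' i) (B' i))))
      (∣m∣n⇒∣m+n (coeffCong r i i≤N) (coeffCong s i i≤N))
    where regroup : ∀ a b c d → (a + b) - (c + d) ≡ (a - c) + (b - d)
          regroup = solve-∀

  ⊖-cong : ∀ {N m A A'} → CongUpTo N m A A' → CongUpTo N m (⊖ A) (⊖ A')
  ⊖-cong {A = A} {A'} r = congUpTo λ i i≤N →
    ∣-respʳ-≡ (sym (trans (cong₂ _-_ (⊖-coeff A i) (⊖-coeff A' i)) (negate (A i) (A' i)))) (∣m⇒∣-m (coeffCong r i i≤N))
    where negate : ∀ a b → - a - - b ≡ - (a - b)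
          negate = solve-∀

  ·-cong : ∀ {N m A A' B B'} → CongUpTo N m A A' → CongUpTo N m B B' → CongUpTo N m (A · B) (A' · B')
  ·-cong {N} {m} {A} {A'} {B} {B'} r s = congUpTo λ i i≤N →
    ∣-respʳ-≡ (sym (trans (cong₂ _-_ (·≡sumℤ A B i) (·≡sumℤ A' B' i))
                      (sumℤ-- (suc i) (λ j → A j * B (i ∸ j)) (λ j → A' j * B' (i ∸ j)))))
      (∣-sumℤ (suc i) _ (λ j j<1+i → ∣-respʳ-≡ (sym (split (A j) (B (i ∸ j)) (A' j) (B' (i ∸ j))))
        (∣m∣n⇒∣m+n (∣m⇒∣m*n (B (i ∸ j)) (coeffCong r j (ℕP.≤-trans (ℕP.≤-pred j<1+i) i≤N)))
                   (∣n⇒∣m*n (A' j) (coeffCong s (i ∸ j) (ℕP.≤-trans (ℕP.m∸n≤m i j) i≤N))))))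
    where split : ∀ a b c d → a * b - c * d ≡ (a - c) * b + c * (b - d)
          split = solve-∀

  CongUpTo-isCommutativeRing : ∀ N m → AS.IsCommutativeRing (CongUpTo N m) _⊕_ _·_ ⊖_ 𝟘 𝟙
  CongUpTo-isCommutativeRing N m = record
    { isRing = record
      { +-isAbelianGroup = record
        { isGroup = record
          { isMonoid = record
            { isSemigroup = record
              { isMagma = record
                { isEquivalence = record { refl = CongUpTo-refl ; sym = CongUpTo-sym ; trans = CongUpTo-trans }
                ; ∙-cong = ⊕-cong }
              ; assoc = λ a b c → ≗⇒≈ (⊕-assoc a b c) }
            ; identity = (λ a → ≗⇒≈ (⊕-identityˡ a)) , (λ a → ≗⇒≈ (⊕-identityʳ a)) }
          ; inverse = (λ a → ≗⇒≈ (⊖-inverseˡ a)) , (λ a → ≗⇒≈ (⊖-inverseʳ a))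
          ; ⁻¹-cong = ⊖-cong }
        ; comm = λ a b → ≗⇒≈ (⊕-comm a b) }
      ; *-cong = ·-cong
      ; *-assoc = λ a b c → ≗⇒≈ (·-assoc a b c)
      ; *-identity = (λ a → ≗⇒≈ (·-identityˡ a)) , (λ a → ≗⇒≈ (·-identityʳ a))
      ; distrib = (λ a b c → ≗⇒≈ (·-distribˡ a b c)) , (λ a b c → ≗⇒≈ (·-distribʳ a b c)) }
    ; *-comm = λ a b → ≗⇒≈ (·-comm a b) }

  truncatedRing : ℕ → ℤ → CommutativeRing 0ℓ 0ℓ
  truncatedRing N m = record { isCommutativeRing = CongUpTo-isCommutativeRing N m }

  truncatedAlmostRing : ℕ → ℤ → AlmostCommutativeRing 0ℓ 0ℓ
  truncatedAlmostRing N m = fromCommutativeRing (truncatedRing N m)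

  ℤ-rawRing : RawRing 0ℓ 0ℓ
  ℤ-rawRing = CommutativeRing.rawRing ℤP.+-*-commutativeRing

  scalar-morphism : ∀ N m → ℤ-rawRing -Raw-AlmostCommutative⟶ truncatedAlmostRing N m
  scalar-morphism N m = record
    { ⟦_⟧ = scalar
    ; +-homo = λ a b → ≗⇒≈ (scalar-+ a b)
    ; *-homo = λ a b → ≗⇒≈ (scalar-* a b)
    ; -‿homo = λ a → ≗⇒≈ (scalar-neg a)
    ; 0-homo = CongUpTo-refl
    ; 1-homo = CongUpTo-refl }

  scalar-≟ : ∀ N m (a b : ℤ) → Maybe (CongUpTo N m (scalar a) (scalar b))
  scalar-≟ N m a b with a ℤ.≟ b
  ... | yes refl = just CongUpTo-refl
  ... | no _ = nothing

  module Solver (N : ℕ) (m : ℤ) where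
    open import Algebra.Solver.Ring ℤ-rawRing (truncatedAlmostRing N m) (scalar-morphism N m) (scalar-≟ N m) public

  scalar-modulus·≈𝟘 : ∀ {N} c X → CongUpTo N c (scalar c · X) 𝟘
  scalar-modulus·≈𝟘 c X = congUpTo λ i _ →
    ∣-respʳ-≡ (sym (trans (cong₂ _-_ (scalar·-coeff c X i) (𝟘-coeff i)) (trans (ℤP.+-identityʳ _) (ℤP.*-comm c (X i)))))
      (divides (X i) refl)

open TruncatedCongruence

module Monomials where
  open import Data.Integer using (_+_; _*_; _-_)

  q^_ : ℕ → Series
  infix 10 q^_
  (q^ e) i with i ℕ.≟ e
  ... | yes _ = + 1
  ... | no _ = + 0

  q^-coeff-self : ∀ e → (q^ e) e ≡ + 1
  q^-coeff-self e with e ℕ.≟ e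
  ... | yes _ = refl
  ... | no ne = ⊥-elim (ne refl)

  q^-coeff-other : ∀ e i → ¬ (i ≡ e) → (q^ e) i ≡ + 0
  q^-coeff-other e i ne with i ℕ.≟ e
  ... | yes eq = ⊥-elim (ne eq)
  ... | no _ = refl

  q^-coeff-iff : ∀ e i e' i' → (i ≡ e → i' ≡ e') → (i' ≡ e' → i ≡ e) → (q^ e) i ≡ (q^ e') i'
  q^-coeff-iff e i e' i' f g with i ℕ.≟ e | i' ℕ.≟ e'
  ... | yes _ | yes _ = refl
  ... | no _ | no _ = refl
  ... | yes p | no q = ⊥-elim (q (f p))
  ... | no p | yes q = ⊥-elim (p (g q))

  q^·-coeff-≥ : ∀ e a i → e ≤ i → (q^ e · a) i ≡ a (i ∸ e)
  q^·-coeff-≥ e a i e≤i = trans (·≡sumℤ (q^ e) a i)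
    (trans (sumℤ-single (suc i) e (λ j → (q^ e) j * a (i ∸ j)) (s≤s e≤i) (λ j _ ne → cong (_* a (i ∸ j)) (q^-coeff-other e j ne)))
      (trans (cong (_* a (i ∸ e)) (q^-coeff-self e)) (ℤP.*-identityˡ _)))

  q^·-coeff-< : ∀ e a i → i < e → (q^ e · a) i ≡ + 0
  q^·-coeff-< e a i i<e = trans (·≡sumℤ (q^ e) a i)
    (sumℤ-zero (suc i) (λ j → (q^ e) j * a (i ∸ j)) (λ j j<si → cong (_* a (i ∸ j))
       (q^-coeff-other e j (λ j≡e → ℕP.<-irrefl refl (ℕP.≤-trans (ℕP.≤-trans i<e (ℕP.≤-reflexive (sym j≡e))) (ℕP.≤-pred j<si))))))

  q^·q^≗q^+ : ∀ a b → q^ a · q^ b ≗ q^ (a ℕ.+ b)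
  q^·q^≗q^+ a b i with a ℕ.≤? i
  ... | yes a≤i = trans (q^·-coeff-≥ a (q^ b) i a≤i)
         (q^-coeff-iff b (i ∸ a) (a ℕ.+ b) i (λ e → trans (sym (ℕP.m+[n∸m]≡n a≤i)) (cong (a ℕ.+_) e))
                                          (λ e → trans (cong (_∸ a) e) (ℕP.m+n∸m≡n a b)))
  ... | no a≰i = trans (q^·-coeff-< a (q^ b) i (ℕP.≰⇒> a≰i))
         (sym (q^-coeff-other (a ℕ.+ b) i (λ e → a≰i (ℕP.≤-trans (ℕP.m≤m+n a b) (ℕP.≤-reflexive (sym e))))))

  q^0≗𝟙 : q^ 0 ≗ 𝟙
  q^0≗𝟙 zero = refl
  q^0≗𝟙 (suc i) = refl

open Monomials

module FiniteProducts where
  open import Data.Nat using (_+_)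

  _^_ : Series → ℕ → Series
  x ^ zero = 𝟙
  x ^ suc n = x ^ n · x

  infixr 9 _^_

  ∏ : ℕ → (ℕ → Series) → Series
  ∏ zero f = 𝟙
  ∏ (suc n) f = ∏ n f · f n

  ∑ : ℕ → (ℕ → Series) → Series
  ∑ zero f = 𝟘
  ∑ (suc n) f = ∑ n f ⊕ f n

  qBinom : Series → ℕ → ℕ → Series
  qBinom Q zero zero = 𝟙
  qBinom Q zero (suc j) = 𝟘
  qBinom Q (suc m) zero = 𝟙
  qBinom Q (suc m) (suc j) = qBinom Q m (suc j) ⊕ Q ^ (m ∸ j) · qBinom Q m j

  qBinom-n0 : ∀ Q m → qBinom Q m 0 ≡ 𝟙
  qBinom-n0 Q zero = refl
  qBinom-n0 Q (suc m) = refl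

  qPoch : Series → ℕ → Series
  qPoch Q n = ∏ n (λ i → 𝟙 ⊕ ⊖ Q ^ suc i)

  tri : ℕ → ℕ
  tri zero = 0
  tri (suc j) = tri j + j

  binomialTerm : Series → Series → Series → ℕ → ℕ → Series
  binomialTerm Q a b m j = qBinom Q m j · Q ^ tri j · a ^ (m ∸ j) · b ^ j

open FiniteProducts

module Reasoning {N : ℕ} {m : ℤ} where
  open import Data.Integer using (_+_; _*_; _-_)

  open CommutativeRing (truncatedRing N m) public using (setoid) renaming (refl to ≈refl; sym to ≈sym; trans to ≈trans)
  open import Relation.Binary.Reasoning.Setoid setoid public
  open Solver N m public
  _≈_ : Series → Series → Set
  _≈_ = CongUpTo N m
  infix 4 _≈_

  ·-congʳ : ∀ {A A'} B → A ≈ A' → A · B ≈ A' · B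
  ·-congʳ B e = ·-cong e ≈refl

  ·-congˡ : ∀ A {B B'} → B ≈ B' → A · B ≈ A · B'
  ·-congˡ A e = ·-cong ≈refl e
  ≡⇒≈ : ∀ {A B} → A ≡ B → A ≈ B
  ≡⇒≈ refl = ≈refl

  ^-+ : ∀ x a b → x ^ (a ℕ.+ b) ≈ x ^ a · x ^ b
  ^-+ x a zero = ≈trans (≡⇒≈ (cong (x ^_) (ℕP.+-identityʳ a))) (≈sym (≗⇒≈ (·-identityʳ (x ^ a))))
  ^-+ x a (suc b) = begin
      x ^ (a ℕ.+ suc b)  ≈⟨ ≡⇒≈ (cong (x ^_) (ℕP.+-suc a b)) ⟩
      x ^ (a ℕ.+ b) · x  ≈⟨ ·-congʳ x (^-+ x a b) ⟩
      x ^ a · x ^ b · x ≈⟨ ≗⇒≈ (·-assoc (x ^ a) (x ^ b) x) ⟩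
      x ^ a · (x ^ b · x) ∎

  ∏-cong : ∀ n {f g} → (∀ i → i < n → f i ≈ g i) → ∏ n f ≈ ∏ n g
  ∏-cong zero e = ≈refl
  ∏-cong (suc n) e = ·-cong (∏-cong n (λ i i<n → e i (ℕP.m≤n⇒m≤1+n i<n))) (e n ℕP.≤-refl)

  ∑-cong : ∀ n {f g} → (∀ i → i < n → f i ≈ g i) → ∑ n f ≈ ∑ n g
  ∑-cong zero e = ≈refl
  ∑-cong (suc n) e = ⊕-cong (∑-cong n (λ i i<n → e i (ℕP.m≤n⇒m≤1+n i<n))) (e n ℕP.≤-refl)

  ∑-uncons : ∀ n f → ∑ (suc n) f ≈ f 0 ⊕ ∑ n (f ∘ suc)
  ∑-uncons zero f = solve 1 (λ a → con (+ 0) :+ a := a :+ con (+ 0)) ≈refl (f 0)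
  ∑-uncons (suc n) f = begin
      ∑ (suc n) f ⊕ f (suc n) ≈⟨ ⊕-cong (∑-uncons n f) ≈refl ⟩
      f 0 ⊕ ∑ n (f ∘ suc) ⊕ f (suc n) ≈⟨ ≗⇒≈ (⊕-assoc (f 0) _ _) ⟩
      f 0 ⊕ (∑ n (f ∘ suc) ⊕ f (suc n)) ∎

  ∑-⊕ : ∀ n f g → ∑ n (λ j → f j ⊕ g j) ≈ ∑ n f ⊕ ∑ n g
  ∑-⊕ zero f g = solve 0 (con (+ 0) := con (+ 0) :+ con (+ 0)) ≈refl
  ∑-⊕ (suc n) f g = begin
      ∑ n (λ j → f j ⊕ g j) ⊕ (f n ⊕ g n) ≈⟨ ⊕-cong (∑-⊕ n f g) ≈refl ⟩
      ∑ n f ⊕ ∑ n g ⊕ (f n ⊕ g n) ≈⟨ solve 4 (λ a b c d → a :+ b :+ (c :+ d) := a :+ c :+ (b :+ d)) ≈refl (∑ n f) (∑ n g) (f n) (g n) ⟩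
      ∑ n f ⊕ f n ⊕ (∑ n g ⊕ g n) ∎

  ∑-·ʳ : ∀ n f c → ∑ n f · c ≈ ∑ n (λ j → f j · c)
  ∑-·ʳ zero f c = solve 1 (λ c → con (+ 0) :* c := con (+ 0)) ≈refl c
  ∑-·ʳ (suc n) f c = begin
      (∑ n f ⊕ f n) · c ≈⟨ ≗⇒≈ (·-distribʳ c (∑ n f) (f n)) ⟩
      ∑ n f · c ⊕ f n · c ≈⟨ ⊕-cong (∑-·ʳ n f c) ≈refl ⟩
      ∑ n (λ j → f j · c) ⊕ f n · c ∎

  ∑-·ˡ : ∀ n f c → c · ∑ n f ≈ ∑ n (λ j → c · f j)
  ∑-·ˡ n f c = ≈trans (≗⇒≈ (·-comm c (∑ n f))) (≈trans (∑-·ʳ n f c) (∑-cong n (λ j _ → ≗⇒≈ (·-comm (f j) c))))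

  q^-^ : ∀ e n → (q^ e) ^ n ≈ q^ (n ℕ.* e)
  q^-^ e zero = ≗⇒≈ (λ i → sym (q^0≗𝟙 i))
  q^-^ e (suc n) = ≈trans (·-congʳ (q^ e) (q^-^ e n)) (≈trans (≗⇒≈ (q^·q^≗q^+ (n ℕ.* e) e))
                       (≡⇒≈ (cong q^_ (ℕP.+-comm (n ℕ.* e) e))))

  q^·q^ : ∀ a b → q^ a · q^ b ≈ q^ (a ℕ.+ b)
  q^·q^ a b = ≗⇒≈ (q^·q^≗q^+ a b)

  ∏-· : ∀ n f g → ∏ n (λ i → f i · g i) ≈ ∏ n f · ∏ n g
  ∏-· zero f g = solve 0 (con (+ 1) := con (+ 1) :* con (+ 1)) ≈refl
  ∏-· (suc n) f g = ≈trans (·-congʳ (f n · g n) (∏-· n f g))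
    (solve 4 (λ a b c d → a :* b :* (c :* d) := a :* c :* (b :* d)) ≈refl (∏ n f) (∏ n g) (f n) (g n))

  ∏-split : ∀ a b f → ∏ (a ℕ.+ b) f ≈ ∏ a f · ∏ b (λ i → f (a ℕ.+ i))
  ∏-split a zero f = ≈trans (≡⇒≈ (cong (λ t → ∏ t f) (ℕP.+-identityʳ a))) (≗⇒≈ (λ i → sym (·-identityʳ (∏ a f) i)))
  ∏-split a (suc b) f = begin
      ∏ (a ℕ.+ suc b) f ≈⟨ ≡⇒≈ (cong (λ t → ∏ t f) (ℕP.+-suc a b)) ⟩
      ∏ (a ℕ.+ b) f · f (a ℕ.+ b) ≈⟨ ·-congʳ (f (a ℕ.+ b)) (∏-split a b f) ⟩
      ∏ a f · ∏ b (λ i → f (a ℕ.+ i)) · f (a ℕ.+ b) ≈⟨ ≗⇒≈ (·-assoc (∏ a f) _ _) ⟩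
      ∏ a f · (∏ b (λ i → f (a ℕ.+ i)) · f (a ℕ.+ b)) ∎

  ∏-uncons : ∀ n f → ∏ (suc n) f ≈ f 0 · ∏ n (f ∘ suc)
  ∏-uncons n f = ≈trans (∏-split 1 n f)
      (·-congʳ (∏ n (f ∘ suc)) (solve 1 (λ x → con (+ 1) :* x := x) ≈refl (f 0)))

  ∏-reverse : ∀ n f → ∏ n f ≈ ∏ n (λ i → f (n ∸ suc i))
  ∏-reverse zero f = ≈refl
  ∏-reverse (suc n) f = begin
      ∏ (suc n) f ≈⟨ ∏-uncons n f ⟩
      f 0 · ∏ n (f ∘ suc) ≈⟨ ·-congˡ (f 0) (∏-reverse n (f ∘ suc)) ⟩
      f 0 · ∏ n (λ i → f (suc (n ∸ suc i))) ≈⟨ ≗⇒≈ (·-comm (f 0) _) ⟩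
      ∏ n (λ i → f (suc (n ∸ suc i))) · f 0
        ≈⟨ ·-cong (∏-cong n (λ i i<n → ≡⇒≈ (cong f (sym (ℕP.+-∸-assoc 1 i<n))))) (≡⇒≈ (cong f (sym (ℕP.n∸n≡0 n)))) ⟩
      ∏ n (λ i → f (n ∸ i)) · f (n ∸ n) ∎

  ∏-q^-linear : ∀ a b n → ∏ n (λ i → q^ (a ℕ.* i ℕ.+ b)) ≈ q^ (a ℕ.* tri n ℕ.+ b ℕ.* n)
  ∏-q^-linear a b zero = ≈trans (≗⇒≈ (λ i → sym (q^0≗𝟙 i))) (≡⇒≈ (cong q^_ (sym (cong₂ ℕ._+_ (ℕP.*-zeroʳ a) (ℕP.*-zeroʳ b)))))
  ∏-q^-linear a b (suc n) = ≈trans (·-congʳ _ (∏-q^-linear a b n)) (≈trans (q^·q^ _ _) (≡⇒≈ (cong q^_ (lem a b n))))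
    where lem : ∀ a b n → a ℕ.* tri n ℕ.+ b ℕ.* n ℕ.+ (a ℕ.* n ℕ.+ b) ≡ a ℕ.* (tri n ℕ.+ n) ℕ.+ b ℕ.* suc n
          lem a b n = solve-∀' a b n (tri n)
            where solve-∀' : ∀ a b n t → a ℕ.* t ℕ.+ b ℕ.* n ℕ.+ (a ℕ.* n ℕ.+ b) ≡ a ℕ.* (t ℕ.+ n) ℕ.+ b ℕ.* suc n
                  solve-∀' = NS.solve-∀

module GaussianBinomials {N : ℕ} {m : ℤ} where
  open import Data.Integer using (_+_; _*_; _-_)
  open Reasoning {N} {m}

  qBinom-vanish : ∀ Q k j → k < j → qBinom Q k j ≈ 𝟘
  qBinom-vanish Q zero (suc j) _ = ≈refl
  qBinom-vanish Q (suc k) (suc j) (s≤s k<j) = begin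
      qBinom Q k (suc j) ⊕ Q ^ (k ∸ j) · qBinom Q k j ≈⟨ ⊕-cong (qBinom-vanish Q k (suc j) (ℕP.m≤n⇒m≤1+n k<j)) (·-congˡ (Q ^ (k ∸ j)) (qBinom-vanish Q k j k<j)) ⟩
      𝟘 ⊕ Q ^ (k ∸ j) · 𝟘 ≈⟨ solve 1 (λ a → con (+ 0) :+ a :* con (+ 0) := con (+ 0)) ≈refl (Q ^ (k ∸ j)) ⟩
      𝟘 ∎

  qBinom-qPoch-diagonal : ∀ Q k → qBinom Q k k · qPoch Q k · qPoch Q 0 ≈ qPoch Q k →
        qBinom Q (suc k) (suc k) · qPoch Q (suc k) · qPoch Q 0 ≈ qPoch Q (suc k)
  qBinom-qPoch-diagonal Q k IH = begin
      (qBinom Q k (suc k) ⊕ Q ^ (k ∸ k) · G) · (P · X) · 𝟙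
    ≈⟨ ·-congʳ 𝟙 (·-congʳ (P · X) (⊕-cong (qBinom-vanish Q k (suc k) ℕP.≤-refl) (·-congʳ G (≡⇒≈ (cong (Q ^_) (ℕP.n∸n≡0 k)))))) ⟩
      (𝟘 ⊕ 𝟙 · G) · (P · X) · 𝟙
    ≈⟨ solve 3 (λ G P X → (con (+ 0) :+ con (+ 1) :* G) :* (P :* X) :* con (+ 1) := (G :* P :* con (+ 1)) :* X) ≈refl G P X ⟩
      (G · P · 𝟙) · X
    ≈⟨ ·-congʳ X IH ⟩
      P · X ∎
    where G = qBinom Q k k
          P = qPoch Q k
          X = 𝟙 ⊕ ⊖ Q ^ suc k

  qBinom-qPoch : ∀ Q k j l → j ℕ.+ l ≡ k → qBinom Q k j · qPoch Q j · qPoch Q l ≈ qPoch Q k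
  qBinom-qPoch Q zero zero zero refl = solve 0 (con (+ 1) :* con (+ 1) :* con (+ 1) := con (+ 1)) ≈refl
  qBinom-qPoch Q (suc k) zero l refl = solve 1 (λ x → con (+ 1) :* con (+ 1) :* x := x) ≈refl (qPoch Q (suc k))
  qBinom-qPoch Q (suc k) (suc j) zero e with trans (sym (ℕP.+-identityʳ j)) (ℕP.suc-injective e)
  ... | refl = qBinom-qPoch-diagonal Q j (qBinom-qPoch Q j j 0 (ℕP.+-identityʳ j))
  qBinom-qPoch Q (suc k) (suc j) (suc l) e = begin
      (G1 ⊕ Q ^ (k ∸ j) · G0) · (A · (𝟙 ⊕ ⊖ X)) · (B · (𝟙 ⊕ ⊖ Y))
    ≈⟨ ·-congʳ (B · (𝟙 ⊕ ⊖ Y)) (·-congʳ (A · (𝟙 ⊕ ⊖ X)) (⊕-cong ≈refl (·-congʳ G0 (≡⇒≈ (cong (Q ^_) k∸j))))) ⟩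
      (G1 ⊕ Y · G0) · (A · (𝟙 ⊕ ⊖ X)) · (B · (𝟙 ⊕ ⊖ Y))
    ≈⟨ solve 6 (λ G1 G0 A B X Y → (G1 :+ Y :* G0) :* (A :* (con (+ 1) :- X)) :* (B :* (con (+ 1) :- Y))
                 := (con (+ 1) :- Y) :* (G1 :* (A :* (con (+ 1) :- X)) :* B) :+ Y :* (con (+ 1) :- X) :* (G0 :* A :* (B :* (con (+ 1) :- Y))))
               ≈refl G1 G0 A B X Y ⟩
      (𝟙 ⊕ ⊖ Y) · (G1 · (A · (𝟙 ⊕ ⊖ X)) · B) ⊕ Y · (𝟙 ⊕ ⊖ X) · (G0 · A · (B · (𝟙 ⊕ ⊖ Y)))
    ≈⟨ ⊕-cong (·-congˡ (𝟙 ⊕ ⊖ Y) (qBinom-qPoch Q k (suc j) l e1)) (·-congˡ (Y · (𝟙 ⊕ ⊖ X)) (qBinom-qPoch Q k j (suc l) e2)) ⟩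
      (𝟙 ⊕ ⊖ Y) · Pk ⊕ Y · (𝟙 ⊕ ⊖ X) · Pk
    ≈⟨ solve 3 (λ X Y P → (con (+ 1) :- Y) :* P :+ Y :* (con (+ 1) :- X) :* P := P :* (con (+ 1) :- Y :* X)) ≈refl X Y Pk ⟩
      Pk · (𝟙 ⊕ ⊖ (Y · X))
    ≈⟨ ·-congˡ Pk (⊕-cong ≈refl (⊖-cong (≈sym (≈trans (^-+ Q (suc l) (suc j)) ≈refl)))) ⟩
      Pk · (𝟙 ⊕ ⊖ Q ^ (suc l ℕ.+ suc j))
    ≈⟨ ·-congˡ Pk (⊕-cong ≈refl (⊖-cong (≡⇒≈ (cong (Q ^_) sk)))) ⟩
      Pk · (𝟙 ⊕ ⊖ Q ^ suc k) ∎
    where G1 = qBinom Q k (suc j)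
          G0 = qBinom Q k j
          A = qPoch Q j
          B = qPoch Q l
          X = Q ^ suc j
          Y = Q ^ suc l
          Pk = qPoch Q k
          e' : j ℕ.+ suc l ≡ k
          e' = ℕP.suc-injective e
          e1 : suc j ℕ.+ l ≡ k
          e1 = trans (sym (ℕP.+-suc j l)) e'
          e2 : j ℕ.+ suc l ≡ k
          e2 = e'
          k∸j : k ∸ j ≡ suc l
          k∸j = trans (cong (_∸ j) (sym e')) (ℕP.m+n∸m≡n j (suc l))
          sk : suc l ℕ.+ suc j ≡ suc k
          sk = trans (ℕP.+-comm (suc l) (suc j)) e

  binomialTerm-·a : ∀ Q a b m j → j ≤ m →
    binomialTerm Q a b m j · a ≈ qBinom Q m j · Q ^ tri j · a ^ (suc m ∸ j) · b ^ j
  binomialTerm-·a Q a b m j j≤m = ≈trans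
    (solve 5 (λ G T A x B → G :* T :* A :* B :* x := G :* T :* (A :* x) :* B) ≈refl (qBinom Q m j) (Q ^ tri j) (a ^ (m ∸ j)) a (b ^ j))
    (·-congʳ (b ^ j) (·-congˡ (qBinom Q m j · Q ^ tri j) (≡⇒≈ (cong (a ^_) (sym (ℕP.+-∸-assoc 1 j≤m))))))

  binomialTerm-·Qᵐb : ∀ Q a b m j → j ≤ m →
    binomialTerm Q a b m j · (Q ^ m · b) ≈ Q ^ (m ∸ j) · qBinom Q m j · Q ^ tri (suc j) · a ^ (m ∸ j) · b ^ suc j
  binomialTerm-·Qᵐb Q a b m j j≤m = begin
      binomialTerm Q a b m j · (Q ^ m · b)
    ≈⟨ ·-congˡ (binomialTerm Q a b m j) (·-congʳ b (≈trans (≡⇒≈ (cong (Q ^_) (sym (ℕP.m∸n+n≡m j≤m)))) (^-+ Q (m ∸ j) j))) ⟩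
      binomialTerm Q a b m j · ((Q ^ (m ∸ j) · Q ^ j) · b)
    ≈⟨ solve 7 (λ D G T J A B x → G :* T :* A :* B :* ((D :* J) :* x) := D :* G :* (T :* J) :* A :* (B :* x)) ≈refl
         (Q ^ (m ∸ j)) (qBinom Q m j) (Q ^ tri j) (Q ^ j) (a ^ (m ∸ j)) (b ^ j) b ⟩
      Q ^ (m ∸ j) · qBinom Q m j · (Q ^ tri j · Q ^ j) · a ^ (m ∸ j) · b ^ suc j
    ≈⟨ ·-congʳ (b ^ suc j) (·-congʳ (a ^ (m ∸ j)) (·-congˡ (Q ^ (m ∸ j) · qBinom Q m j) (≈sym (^-+ Q (tri j) j)))) ⟩
      Q ^ (m ∸ j) · qBinom Q m j · Q ^ tri (suc j) · a ^ (m ∸ j) · b ^ suc j ∎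

  -- The q-Pascal recurrence defining qBinom, read at the term j + 1 of the next row.
  binomialTerm-pascal : ∀ Q a b m j →
    qBinom Q m (suc j) · Q ^ tri (suc j) · a ^ (m ∸ j) · b ^ suc j ⊕ Q ^ (m ∸ j) · qBinom Q m j · Q ^ tri (suc j) · a ^ (m ∸ j) · b ^ suc j
      ≈ binomialTerm Q a b (suc m) (suc j)
  binomialTerm-pascal Q a b m j =
    solve 6 (λ G₁ D G₀ T A B → G₁ :* T :* A :* B :+ D :* G₀ :* T :* A :* B := (G₁ :+ D :* G₀) :* T :* A :* B) ≈refl
      (qBinom Q m (suc j)) (Q ^ (m ∸ j)) (qBinom Q m j) (Q ^ tri (suc j)) (a ^ (m ∸ j)) (b ^ suc j)

  qBinomial-step : ∀ Q a b m →
    ∑ (suc m) (binomialTerm Q a b m) · (a ⊕ Q ^ m · b) ≈ ∑ (suc (suc m)) (binomialTerm Q a b (suc m))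
  qBinomial-step Q a b m = begin
      ∑ (suc m) t · (a ⊕ Q ^ m · b)
    ≈⟨ ≗⇒≈ (·-distribˡ (∑ (suc m) t) a (Q ^ m · b)) ⟩
      ∑ (suc m) t · a ⊕ ∑ (suc m) t · (Q ^ m · b)
    ≈⟨ ⊕-cong (≈trans (∑-·ʳ (suc m) t a) (∑-cong (suc m) (λ j j<1+m → binomialTerm-·a Q a b m j (ℕP.≤-pred j<1+m))))
              (≈trans (∑-·ʳ (suc m) t (Q ^ m · b)) (∑-cong (suc m) (λ j j<1+m → binomialTerm-·Qᵐb Q a b m j (ℕP.≤-pred j<1+m)))) ⟩
      ∑ (suc m) byA ⊕ ∑ (suc m) byQᵐb
    ≈⟨ ⊕-cong (≈trans (≈sym (≈trans (⊕-cong ≈refl byA-vanishes) (≗⇒≈ (⊕-identityʳ _)))) (∑-uncons (suc m) byA)) ≈refl ⟩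
      byA 0 ⊕ ∑ (suc m) (byA ∘ suc) ⊕ ∑ (suc m) byQᵐb
    ≈⟨ ≈trans (≗⇒≈ (⊕-assoc (byA 0) _ _)) (⊕-cong (≡⇒≈ (cong (λ G → G · 𝟙 · a ^ suc m · 𝟙) (qBinom-n0 Q m))) (≈sym (∑-⊕ (suc m) _ _))) ⟩
      binomialTerm Q a b (suc m) 0 ⊕ ∑ (suc m) (λ j → byA (suc j) ⊕ byQᵐb j)
    ≈⟨ ⊕-cong ≈refl (∑-cong (suc m) (λ j _ → binomialTerm-pascal Q a b m j)) ⟩
      binomialTerm Q a b (suc m) 0 ⊕ ∑ (suc m) (binomialTerm Q a b (suc m) ∘ suc)
    ≈⟨ ≈sym (∑-uncons (suc m) (binomialTerm Q a b (suc m))) ⟩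
      ∑ (suc (suc m)) (binomialTerm Q a b (suc m)) ∎
    where
      t byA byQᵐb : ℕ → Series
      t = binomialTerm Q a b m
      byA j = qBinom Q m j · Q ^ tri j · a ^ (suc m ∸ j) · b ^ j
      byQᵐb j = Q ^ (m ∸ j) · qBinom Q m j · Q ^ tri (suc j) · a ^ (m ∸ j) · b ^ suc j
      byA-vanishes : byA (suc m) ≈ 𝟘
      byA-vanishes = ≈trans (·-congʳ (b ^ suc m) (·-congʳ (a ^ (suc m ∸ suc m)) (·-congʳ (Q ^ tri (suc m)) (qBinom-vanish Q m (suc m) ℕP.≤-refl))))
        (solve 3 (λ x y z → con (+ 0) :* x :* y :* z := con (+ 0)) ≈refl (Q ^ tri (suc m)) (a ^ (suc m ∸ suc m)) (b ^ suc m))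

  qBinomial-theorem : ∀ Q a b m → ∏ m (λ k → a ⊕ Q ^ k · b) ≈ ∑ (suc m) (binomialTerm Q a b m)
  qBinomial-theorem Q a b zero = solve 0 (con (+ 1) := con (+ 0) :+ con (+ 1) :* con (+ 1) :* con (+ 1) :* con (+ 1)) ≈refl
  qBinomial-theorem Q a b (suc m) =
    ≈trans (·-congʳ (a ⊕ Q ^ m · b) (qBinomial-theorem Q a b m)) (qBinomial-step Q a b m)

module Truncation where
  open import Data.Integer using (_+_; _*_; _-_)
  open import Data.Integer.Divisibility.Signed using (_∣_; divides; ∣m∣n⇒∣m+n; ∣m⇒∣-m; ∣n⇒∣m*n; ∣m⇒∣m*n; 0∣⇒≡0; *-monoʳ-∣; ∣⇒∣ᵤ)

  exact⇒CongUpTo : ∀ {N m A B} → CongUpTo N (+ 0) A B → CongUpTo N m A B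
  exact⇒CongUpTo {A = A} {B} r = congUpTo λ i i≤N → ∣-respʳ-≡ (sym (0∣⇒≡0 (coeffCong r i i≤N))) (divides (+ 0) refl)

  exact⇒≡ : ∀ {N A B} → CongUpTo N (+ 0) A B → ∀ i → i ≤ N → A i ≡ B i
  exact⇒≡ {A = A} {B} r i i≤N = ℤP.i-j≡0⇒i≡j (A i) (B i) (0∣⇒≡0 (coeffCong r i i≤N))

  ≡⇒exact : ∀ {N A B} → (∀ i → i ≤ N → A i ≡ B i) → CongUpTo N (+ 0) A B
  ≡⇒exact {A = A} {B} e = congUpTo λ i i≤N → ∣-respʳ-≡ (sym (trans (cong (λ t → A i - t) (sym (e i i≤N))) (ℤP.+-inverseʳ (A i)))) (divides (+ 0) refl)

  -- Factors that equal 1 up to degree i: up to degree N, their infinite product is the product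
  -- of the first N factors.
  Admissible : (ℕ → Series) → Set
  Admissible f = ∀ i → CongUpTo i (+ 0) (f i) 𝟙

  ∏-stable : ∀ f → Admissible f → ∀ {N M m} → N ≤ M → CongUpTo N m (∏ M f) (∏ N f)
  ∏-stable f ad {N} {zero} z≤n = CongUpTo-refl
  ∏-stable f ad {N} {suc M} {m} N≤1+M with ℕP.m≤n⇒m<n∨m≡n N≤1+M
  ... | inj₂ refl = CongUpTo-refl
  ... | inj₁ (s≤s N≤M) = begin
      ∏ M f · f M ≈⟨ ·-cong (∏-stable f ad N≤M) (exact⇒CongUpTo (CongUpTo-mono N≤M (ad M))) ⟩
      ∏ N f · 𝟙   ≈⟨ ≗⇒≈ (·-identityʳ (∏ N f)) ⟩
      ∏ N f       ∎
    where open Reasoning {N} {m}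

  ∏-stable₂ : ∀ f → Admissible f → ∀ {N M M' m} → N ≤ M → N ≤ M' → CongUpTo N m (∏ M f) (∏ M' f)
  ∏-stable₂ f ad N≤M N≤M' = CongUpTo-trans (∏-stable f ad N≤M) (CongUpTo-sym (∏-stable f ad N≤M'))

  admissible-constantTerm : ∀ {i A} → CongUpTo i (+ 0) A 𝟙 → A 0 ≡ + 1
  admissible-constantTerm r = exact⇒≡ r 0 z≤n

  ∏-constantTerm : ∀ n f → (∀ i → f i 0 ≡ + 1) → ∏ n f 0 ≡ + 1
  ∏-constantTerm zero f h = refl
  ∏-constantTerm (suc n) f h = trans (·-constantTerm (∏ n f) (f n)) (cong₂ _*_ (∏-constantTerm n f h) (h n))

  ·-cancelʳ-unit : ∀ {N m A B C} → C 0 ≡ + 1 → CongUpTo N m (A · C) (B · C) → CongUpTo N m A B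
  ·-cancelʳ-unit {N} {m} {A} {B} {C} c1 r = congUpTo λ i i≤N → below (suc i) (s≤s i≤N) i ℕP.≤-refl
    where
      lem-cancel : ∀ s1 s2 a b → a - b ≡ ((s1 + a * + 1) - (s2 + b * + 1)) - (s1 - s2)
      lem-cancel = solve-∀
      lem-dist : ∀ a b c → a * c - b * c ≡ (a - b) * c
      lem-dist = solve-∀
      D : ℕ → ℤ
      D i = A i - B i
      step : ∀ i → i ≤ N → (∀ j → j < i → m ∣ (D j)) → m ∣ (D i)
      step i i≤N ih = ∣-respʳ-≡ (sym eq) (∣m∣n⇒∣m+n (coeffCong r i i≤N) (∣m⇒∣-m (∣-respʳ-≡ (sym (sumℤ-- i _ _))
                         (∣-sumℤ i _ (λ j j<i → ∣-respʳ-≡ (sym (lem-dist (A j) (B j) (C (i ∸ j)))) (∣m⇒∣m*n (C (i ∸ j)) (ih j j<i)))))))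
        where
          c' : C (i ∸ i) ≡ + 1
          c' = trans (cong C (ℕP.n∸n≡0 i)) c1
          eA : (A · C) i ≡ sumℤ i (λ j → A j * C (i ∸ j)) + A i * + 1
          eA = trans (·≡sumℤ A C i) (trans (sumℤ-snoc i (λ j → A j * C (i ∸ j))) (cong (λ t → sumℤ i (λ j → A j * C (i ∸ j)) + A i * t) c'))
          eB : (B · C) i ≡ sumℤ i (λ j → B j * C (i ∸ j)) + B i * + 1
          eB = trans (·≡sumℤ B C i) (trans (sumℤ-snoc i (λ j → B j * C (i ∸ j))) (cong (λ t → sumℤ i (λ j → B j * C (i ∸ j)) + B i * t) c'))
          eq : D i ≡ ((A · C) i - (B · C) i) + - (sumℤ i (λ j → A j * C (i ∸ j)) - sumℤ i (λ j → B j * C (i ∸ j)))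
          eq = trans (lem-cancel (sumℤ i (λ j → A j * C (i ∸ j))) (sumℤ i (λ j → B j * C (i ∸ j))) (A i) (B i))
                       (cong₂ (λ u v → (u - v) - (sumℤ i (λ j → A j * C (i ∸ j)) - sumℤ i (λ j → B j * C (i ∸ j)))) (sym eA) (sym eB))
      below : ∀ k → k ≤ suc N → ∀ j → j < k → m ∣ (D j)
      below zero _ j ()
      below (suc k) sk≤ j j<sk with ℕP.m≤n⇒m<n∨m≡n (ℕP.≤-pred j<sk)
      ... | inj₁ j<k = below k (ℕP.m≤n⇒m≤1+n (ℕP.≤-pred sk≤)) j j<k
      ... | inj₂ refl = step j (ℕP.≤-pred sk≤) (below j (ℕP.m≤n⇒m≤1+n (ℕP.≤-pred sk≤)))

  q^·-cancel : ∀ {N m} a X Y → CongUpTo (N ℕ.+ a) m (q^ a · X) (q^ a · Y) → CongUpTo N m X Y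
  q^·-cancel {N} {m} a X Y r = congUpTo λ i i≤N → ∣-respʳ-≡ (cong₂ _-_ (e X i) (e Y i)) (coeffCong r (i ℕ.+ a) (ℕP.+-monoˡ-≤ a i≤N))
    where e : ∀ Z i → (q^ a · Z) (i ℕ.+ a) ≡ Z i
          e Z i = trans (q^·-coeff-≥ a Z (i ℕ.+ a) (ℕP.m≤n+m a i)) (cong Z (ℕP.m+n∸n≡m i a))

  q^·-vanish : ∀ {N m} e X → N < e → CongUpTo N m (q^ e · X) 𝟘
  q^·-vanish {N} {m} e X N<e = congUpTo λ i i≤N → ∣-respʳ-≡ (sym (trans (cong₂ _-_ (q^·-coeff-< e X i (ℕP.≤-<-trans i≤N N<e)) (𝟘-coeff i)) refl)) (divides (+ 0) refl)

  [1-q^_] : ℕ → Series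
  [1-q^ d ] = 𝟙 ⊕ ⊖ q^ d

  [1+q^_] : ℕ → Series
  [1+q^ d ] = 𝟙 ⊕ q^ d

  q^-high : ∀ d i → i < d → CongUpTo i (+ 0) (q^ d) 𝟘
  q^-high d i i<d = ≡⇒exact (λ j j≤i → trans (q^-coeff-other d j (λ j≡d → ℕP.<-irrefl j≡d (ℕP.≤-<-trans j≤i i<d))) (sym (𝟘-coeff j)))

  [1-q^]-admissible : ∀ d i → i < d → CongUpTo i (+ 0) [1-q^ d ] 𝟙
  [1-q^]-admissible d i i<d = ≈trans (⊕-cong ≈refl (⊖-cong (q^-high d i i<d))) (solve 0 (con (+ 1) :- con (+ 0) := con (+ 1)) ≈refl)
    where open Reasoning {i} {+ 0}

  [1+q^]-admissible : ∀ d i → i < d → CongUpTo i (+ 0) [1+q^ d ] 𝟙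
  [1+q^]-admissible d i i<d = ≈trans (⊕-cong ≈refl (q^-high d i i<d)) (solve 0 (con (+ 1) :+ con (+ 0) := con (+ 1)) ≈refl)
    where open Reasoning {i} {+ 0}

  qPoch-factor : ℕ → ℕ → Series
  qPoch-factor c i = 𝟙 ⊕ ⊖ (q^ c) ^ suc i

  qPoch-factor-admissible : ∀ c → 1 ≤ c → Admissible (qPoch-factor c)
  qPoch-factor-admissible (suc c) _ i = ≈trans (⊕-cong ≈refl (⊖-cong (q^-^ (suc c) (suc i)))) ([1-q^]-admissible (suc i ℕ.* suc c) i (s≤s (ℕP.≤-trans (ℕP.m≤m*n i (suc c)) (ℕP.m≤n+m _ c))))
    where open Reasoning {i} {+ 0}

  qPoch-constantTerm : ∀ c → 1 ≤ c → ∀ M → qPoch (q^ c) M 0 ≡ + 1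
  qPoch-constantTerm c 1≤c M = ∏-constantTerm M (qPoch-factor c) (λ i → admissible-constantTerm (qPoch-factor-admissible c 1≤c i))

  -- In low degrees [j + l, j]_Q · (Q; Q)_∞ ≡ 1: the Gaussian binomials of the finite triple product
  -- tend to 1/(Q; Q)_∞.
  qBinom·qPoch≈𝟙 : ∀ {N m} c → 1 ≤ c → ∀ j l M → N ≤ j → N ≤ l → N ≤ M → CongUpTo N m (qBinom (q^ c) (j ℕ.+ l) j · qPoch (q^ c) M) 𝟙
  qBinom·qPoch≈𝟙 {N} {m} c 1≤c j l M N≤j N≤l N≤M = ·-cancelʳ-unit (qPoch-constantTerm c 1≤c M) (begin
      qBinom Q (j ℕ.+ l) j · qM · qM ≈⟨ ·-cong (·-congˡ (qBinom Q (j ℕ.+ l) j) (CongUpTo-sym sj)) (CongUpTo-sym sl) ⟩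
      qBinom Q (j ℕ.+ l) j · qPoch Q j · qPoch Q l ≈⟨ qBinom-qPoch Q (j ℕ.+ l) j l refl ⟩
      qPoch Q (j ℕ.+ l) ≈⟨ sjl ⟩
      qM ≈⟨ ≗⇒≈ (λ i → sym (·-identityˡ qM i)) ⟩
      𝟙 · qM ∎)
    where
      open Reasoning {N} {m}
      open GaussianBinomials {N} {m}
      Q = q^ c
      qM = qPoch Q M
      ad = qPoch-factor-admissible c 1≤c
      sj : qPoch Q j ≈ qM
      sj = ∏-stable₂ (qPoch-factor c) ad N≤j N≤M
      sl : qPoch Q l ≈ qM
      sl = ∏-stable₂ (qPoch-factor c) ad N≤l N≤M
      sjl : qPoch Q (j ℕ.+ l) ≈ qM
      sjl = ∏-stable₂ (qPoch-factor c) ad (ℕP.≤-trans N≤j (ℕP.m≤m+n j l)) N≤M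

  q^·qBinom·qPoch≈q^ : ∀ {N m} c → 1 ≤ c → ∀ d j l M → N ≤ M → (d ≤ N → (N ≤ j) × (N ≤ l)) →
       CongUpTo N m (q^ d · (qBinom (q^ c) (j ℕ.+ l) j · qPoch (q^ c) M)) (q^ d)
  q^·qBinom·qPoch≈q^ {N} {m} c 1≤c d j l M N≤M h with d ℕ.≤? N
  ... | yes d≤N = ≈trans (·-congˡ (q^ d) (qBinom·qPoch≈𝟙 c 1≤c j l M (proj₁ (h d≤N)) (proj₂ (h d≤N)) N≤M)) (≗⇒≈ (·-identityʳ (q^ d)))
    where open Reasoning {N} {m}
  ... | no d≰N = ≈trans (q^·-vanish d _ (ℕP.≰⇒> d≰N)) (≈sym (≈trans (≗⇒≈ (λ i → sym (·-identityʳ (q^ d) i))) (q^·-vanish d 𝟙 (ℕP.≰⇒> d≰N))))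
    where open Reasoning {N} {m}

  ≤-∸-of-double : ∀ N k s → N ℕ.+ N ≤ k → suc s ≤ N → N ≤ k ∸ s
  ≤-∸-of-double N k s NN≤k ss≤N = ℕP.m+n≤o⇒m≤o∸n N (ℕP.≤-trans (ℕP.+-monoʳ-≤ N (ℕP.≤-trans (ℕP.n≤1+n s) ss≤N)) NN≤k)

  K+K≡above+below : ∀ K s → suc s ≤ K → K ℕ.+ K ≡ (K ℕ.+ suc s) ℕ.+ (K ∸ suc s)
  K+K≡above+below K s le = trans (cong (K ℕ.+_) (sym (ℕP.m+[n∸m]≡n le))) (sym (ℕP.+-assoc K (suc s) (K ∸ suc s)))

  q^·qBinom-above : ∀ {N m} c → 1 ≤ c → ∀ k s d M → suc s ≤ suc k → suc s ≤ d → N ℕ.+ N ≤ k → N ≤ M →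
    CongUpTo N m (q^ d · (qBinom (q^ c) (suc k ℕ.+ suc k) (suc k ℕ.+ suc s) · qPoch (q^ c) M)) (q^ d)
  q^·qBinom-above {N} {m} c 1≤c k s d M le s<d NN≤k N≤M =
    subst (λ n → CongUpTo N m (q^ d · (qBinom (q^ c) n (suc k ℕ.+ suc s) · qPoch (q^ c) M)) (q^ d))
      (sym (K+K≡above+below (suc k) s le)) (q^·qBinom·qPoch≈q^ c 1≤c d (suc k ℕ.+ suc s) (suc k ∸ suc s) M N≤M
      (λ d≤N → ℕP.≤-trans (ℕP.m+n≤o⇒m≤o _ NN≤k) (ℕP.≤-trans (ℕP.n≤1+n k) (ℕP.m≤m+n (suc k) (suc s)))
             , ≤-∸-of-double _ k s NN≤k (ℕP.≤-trans s<d d≤N)))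

  q^·qBinom-below : ∀ {N m} c → 1 ≤ c → ∀ k s d M → suc s ≤ suc k → suc s ≤ d → N ℕ.+ N ≤ k → N ≤ M →
    CongUpTo N m (q^ d · (qBinom (q^ c) (suc k ℕ.+ suc k) (suc k ∸ suc s) · qPoch (q^ c) M)) (q^ d)
  q^·qBinom-below {N} {m} c 1≤c k s d M le s<d NN≤k N≤M =
    subst (λ n → CongUpTo N m (q^ d · (qBinom (q^ c) n (suc k ∸ suc s) · qPoch (q^ c) M)) (q^ d))
      (sym (trans (K+K≡above+below (suc k) s le) (ℕP.+-comm (suc k ℕ.+ suc s) (suc k ∸ suc s)))) (q^·qBinom·qPoch≈q^ c 1≤c d (suc k ∸ suc s) (suc k ℕ.+ suc s) M N≤M
      (λ d≤N → ≤-∸-of-double _ k s NN≤k (ℕP.≤-trans s<d d≤N)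
             , ℕP.≤-trans (ℕP.m+n≤o⇒m≤o _ NN≤k) (ℕP.≤-trans (ℕP.n≤1+n k) (ℕP.m≤m+n (suc k) (suc s)))))

  ∑-fold-symmetric : ∀ {N m} K g → CongUpTo N m (∑ (suc (K ℕ.+ K)) g) (g K ⊕ ∑ K (λ s → g (K ℕ.+ suc s) ⊕ g (K ∸ suc s)))
  ∑-fold-symmetric {N} {m} zero g = solve 1 (λ a → con (+ 0) :+ a := a :+ con (+ 0)) ≈refl (g 0)
    where open Reasoning {N} {m}
  ∑-fold-symmetric {N} {m} (suc K) g = begin
      ∑ (suc (suc K ℕ.+ suc K)) g
    ≈⟨ ≡⇒≈ (cong (λ t → ∑ (suc (suc t)) g) (ℕP.+-suc K K)) ⟩
      ∑ (suc (suc (K ℕ.+ K))) g ⊕ g (suc (suc (K ℕ.+ K)))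
    ≈⟨ ⊕-cong (∑-uncons (suc (K ℕ.+ K)) g) ≈refl ⟩
      g 0 ⊕ ∑ (suc (K ℕ.+ K)) (g ∘ suc) ⊕ g (suc (suc (K ℕ.+ K)))
    ≈⟨ ⊕-cong (⊕-cong ≈refl (∑-fold-symmetric K (g ∘ suc))) ≈refl ⟩
      g 0 ⊕ (g (suc K) ⊕ ∑ K (λ s → g (suc (K ℕ.+ suc s)) ⊕ g (suc (K ∸ suc s)))) ⊕ g (suc (suc (K ℕ.+ K)))
    ≈⟨ ⊕-cong (⊕-cong ≈refl (⊕-cong ≈refl (∑-cong K (λ s s<K → ≡⇒≈ (cong (λ t → g (suc (K ℕ.+ suc s)) ⊕ g t) (sym (ℕP.+-∸-assoc 1 s<K))))))) ≈refl ⟩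
      g 0 ⊕ (g (suc K) ⊕ ∑ K (λ s → g (suc K ℕ.+ suc s) ⊕ g (suc K ∸ suc s))) ⊕ g (suc (suc (K ℕ.+ K)))
    ≈⟨ solve 4 (λ a b c d → a :+ (b :+ c) :+ d := b :+ (c :+ (d :+ a))) ≈refl (g 0) (g (suc K)) _ (g (suc (suc (K ℕ.+ K)))) ⟩
      g (suc K) ⊕ (∑ K (λ s → g (suc K ℕ.+ suc s) ⊕ g (suc K ∸ suc s)) ⊕ (g (suc (suc (K ℕ.+ K))) ⊕ g 0))
    ≈⟨ ⊕-cong ≈refl (⊕-cong ≈refl (≡⇒≈ (cong₂ (λ u v → g u ⊕ g v) (cong suc (sym (ℕP.+-suc K K))) (sym (ℕP.n∸n≡0 K))))) ⟩
      g (suc K) ⊕ ∑ (suc K) (λ s → g (suc K ℕ.+ suc s) ⊕ g (suc K ∸ suc s)) ∎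
    where open Reasoning {N} {m}

open Truncation

module JacobiTripleProduct where
  open import Data.Nat using (_+_; _*_)

  tri-double : ∀ x → tri x * 2 + x ≡ x * x
  tri-double zero = refl
  tri-double (suc x) = trans (lem (tri x) x) (trans (cong (λ t → t + 2 * x + 1) (tri-double x)) (square-suc x))
    where lem : ∀ t x → (t + x) * 2 + suc x ≡ (t * 2 + x) + 2 * x + 1
          lem = NS.solve-∀
          square-suc : ∀ x → x * x + 2 * x + 1 ≡ suc x * suc x
          square-suc = NS.solve-∀

  -- With Q = q^(2c) and a = q^((2k+1)c), the j-th term of the q-binomial expansion of
  -- ∏_{i < 2k+2} (a + Qⁱ z) has the monomial q^(c · termExponent k j); it is smallest at j = k + 1.
  termExponent : ℕ → ℕ → ℕ
  termExponent k j = tri j * 2 + (suc k + suc k ∸ j) * suc (k + k)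

  centralExponent : ℕ → ℕ
  centralExponent k = tri (suc k) * 2 + suc k * suc (k + k)

  termExponent-centre : ∀ k → termExponent k (suc k) ≡ centralExponent k
  termExponent-centre k = cong (λ t → tri (suc k) * 2 + t * suc (k + k)) (ℕP.m+n∸m≡n (suc k) (suc k))

  termExponent-+ : ∀ k j r → j + r ≡ suc k + suc k → termExponent k j + j ≡ j * j + r * suc (k + k)
  termExponent-+ k j r j+r≡KK = begin
      tri j * 2 + (suc k + suc k ∸ j) * suc (k + k) + j
        ≡⟨ cong (λ t → tri j * 2 + t * suc (k + k) + j) (trans (cong (_∸ j) (sym j+r≡KK)) (ℕP.m+n∸m≡n j r)) ⟩
      tri j * 2 + r * suc (k + k) + j  ≡⟨ swap (tri j * 2) (r * suc (k + k)) j ⟩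
      tri j * 2 + j + r * suc (k + k)  ≡⟨ cong (_+ r * suc (k + k)) (tri-double j) ⟩
      j * j + r * suc (k + k)          ∎
    where open ≡-Reasoning
          swap : ∀ a b c → a + b + c ≡ a + c + b
          swap = NS.solve-∀

  termExponent-offset : ∀ k j r t → j + r ≡ suc k + suc k →
    j * j + r * suc (k + k) + suc k ≡ suc k * suc k + suc k * suc (k + k) + t * t + j →
    termExponent k j ≡ centralExponent k + t * t
  termExponent-offset k j r t j+r≡KK poly = ℕP.+-cancelʳ-≡ (j + suc k) _ _ (begin
      termExponent k j + (j + suc k)                    ≡⟨ sym (ℕP.+-assoc (termExponent k j) j (suc k)) ⟩
      termExponent k j + j + suc k                      ≡⟨ cong (_+ suc k) (termExponent-+ k j r j+r≡KK) ⟩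
      j * j + r * suc (k + k) + suc k                   ≡⟨ poly ⟩
      suc k * suc k + suc k * suc (k + k) + t * t + j   ≡⟨ cong (λ x → x + t * t + j) (sym centre+K) ⟩
      centralExponent k + suc k + t * t + j             ≡⟨ rearrange (centralExponent k) (suc k) (t * t) j ⟩
      centralExponent k + t * t + (j + suc k)           ∎)
    where
      open ≡-Reasoning
      centre+K : centralExponent k + suc k ≡ suc k * suc k + suc k * suc (k + k)
      centre+K = trans (cong (_+ suc k) (sym (termExponent-centre k))) (termExponent-+ k (suc k) (suc k) refl)
      rearrange : ∀ e K u j → e + K + u + j ≡ e + u + (j + K)
      rearrange = NS.solve-∀

  termExponent-above : ∀ s r → let k = s + r in termExponent k (suc k + suc s) ≡ centralExponent k + suc s * suc s
  termExponent-above s r = termExponent-offset (s + r) (suc (s + r) + suc s) r (suc s)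
    (ℕP.+-assoc (suc (s + r)) (suc s) r) (poly s r)
    where poly : ∀ s r → let K = suc (s + r); j = K + suc s in
                 j * j + r * suc ((s + r) + (s + r)) + K ≡ K * K + K * suc ((s + r) + (s + r)) + suc s * suc s + j
          poly = NS.solve-∀

  termExponent-below : ∀ s r → let k = s + r in termExponent k (suc k ∸ suc s) ≡ centralExponent k + suc s * suc s
  termExponent-below s r = trans (cong (termExponent (s + r)) (ℕP.m+n∸m≡n s r))
    (termExponent-offset (s + r) r (suc (s + r) + suc s) (suc s) (sum s r) (poly s r))
    where sum : ∀ s r → r + (suc (s + r) + suc s) ≡ suc (s + r) + suc (s + r)
          sum = NS.solve-∀
          poly : ∀ s r → let K = suc (s + r) in
                 r * r + (K + suc s) * suc ((s + r) + (s + r)) + K ≡ K * K + K * suc ((s + r) + (s + r)) + suc s * suc s + r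
          poly = NS.solve-∀

  -- Finite Jacobi triple product: the terms j = k + 1 ± (s + 1) both carry q^(c (s + 1)²) beyond the centre.
  module FiniteJacobi {N : ℕ} {m : ℤ} (c : ℕ) (z : Series) (k : ℕ) where
    open Reasoning {N} {m}
    open GaussianBinomials {N} {m}
    K KK : ℕ
    K = suc k
    KK = K + K
    Qc a : Series
    Qc = q^ (2 * c)
    a = q^ (suc (k + k) * c)
    g : ℕ → Series
    g = binomialTerm Qc a z KK

    gterm : ∀ j x → termExponent k j ≡ x → g j ≈ q^ (x * c) · (qBinom Qc KK j · z ^ j)
    gterm j x e = begin
        qBinom Qc KK j · Qc ^ tri j · a ^ (KK ∸ j) · z ^ j
      ≈⟨ ·-congʳ (z ^ j) (·-cong (·-congˡ (qBinom Qc KK j) (q^-^ (2 * c) (tri j))) (q^-^ (suc (k + k) * c) (KK ∸ j))) ⟩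
        qBinom Qc KK j · q^ (tri j * (2 * c)) · q^ ((KK ∸ j) * (suc (k + k) * c)) · z ^ j
      ≈⟨ solve 4 (λ G A B Z → G :* A :* B :* Z := (A :* B) :* (G :* Z)) ≈refl (qBinom Qc KK j) (q^ (tri j * (2 * c))) (q^ ((KK ∸ j) * (suc (k + k) * c))) (z ^ j) ⟩
        (q^ (tri j * (2 * c)) · q^ ((KK ∸ j) * (suc (k + k) * c))) · (qBinom Qc KK j · z ^ j)
      ≈⟨ ·-congʳ _ (≈trans (q^·q^ _ _) (≡⇒≈ (cong q^_ (trans (arith (tri j) (KK ∸ j) (suc (k + k)) c) (cong (_* c) e))))) ⟩
        q^ (x * c) · (qBinom Qc KK j · z ^ j) ∎
      where arith : ∀ t y w c → t * (2 * c) + y * (w * c) ≡ (t * 2 + y * w) * c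
            arith = NS.solve-∀

    split : ∀ x → q^ ((centralExponent k + x) * c) ≈ q^ (centralExponent k * c) · q^ (x * c)
    split x = ≈trans (≡⇒≈ (cong q^_ (ℕP.*-distribʳ-+ c (centralExponent k) x))) (≈sym (q^·q^ _ _))

    jacobi-triple-product : ∏ KK (λ i → a ⊕ Qc ^ i · z) ≈
             q^ (centralExponent k * c) · (qBinom Qc KK K · z ^ K ⊕
               ∑ K (λ s → q^ (suc s * suc s * c) · (qBinom Qc KK (K + suc s) · z ^ (K + suc s) ⊕ qBinom Qc KK (K ∸ suc s) · z ^ (K ∸ suc s))))
    jacobi-triple-product = begin
        ∏ KK (λ i → a ⊕ Qc ^ i · z)
      ≈⟨ qBinomial-theorem Qc a z KK ⟩
        ∑ (suc KK) g
      ≈⟨ ∑-fold-symmetric K g ⟩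
        g K ⊕ ∑ K (λ s → g (K + suc s) ⊕ g (K ∸ suc s))
      ≈⟨ ⊕-cong (gterm K (centralExponent k) (termExponent-centre k)) (∑-cong K (λ s s<K → pair s (ℕP.≤-pred s<K))) ⟩
        q^ (centralExponent k * c) · (qBinom Qc KK K · z ^ K) ⊕ ∑ K (λ s → q^ (centralExponent k * c) · (q^ (suc s * suc s * c) · (qBinom Qc KK (K + suc s) · z ^ (K + suc s) ⊕ qBinom Qc KK (K ∸ suc s) · z ^ (K ∸ suc s))))
      ≈⟨ ⊕-cong ≈refl (≈sym (∑-·ˡ K _ (q^ (centralExponent k * c)))) ⟩
        q^ (centralExponent k * c) · (qBinom Qc KK K · z ^ K) ⊕ q^ (centralExponent k * c) · ∑ K (λ s → q^ (suc s * suc s * c) · (qBinom Qc KK (K + suc s) · z ^ (K + suc s) ⊕ qBinom Qc KK (K ∸ suc s) · z ^ (K ∸ suc s)))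
      ≈⟨ ≈sym (≗⇒≈ (·-distribˡ (q^ (centralExponent k * c)) _ _)) ⟩
        q^ (centralExponent k * c) · (qBinom Qc KK K · z ^ K ⊕
               ∑ K (λ s → q^ (suc s * suc s * c) · (qBinom Qc KK (K + suc s) · z ^ (K + suc s) ⊕ qBinom Qc KK (K ∸ suc s) · z ^ (K ∸ suc s)))) ∎
      where
        pair : ∀ s → s ≤ k → g (K + suc s) ⊕ g (K ∸ suc s) ≈ q^ (centralExponent k * c) · (q^ (suc s * suc s * c) · (qBinom Qc KK (K + suc s) · z ^ (K + suc s) ⊕ qBinom Qc KK (K ∸ suc s) · z ^ (K ∸ suc s)))
        pair s s≤k = begin
            g (K + suc s) ⊕ g (K ∸ suc s)
          ≈⟨ ⊕-cong (gterm (K + suc s) _ xp) (gterm (K ∸ suc s) _ xm) ⟩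
            q^ ((centralExponent k + suc s * suc s) * c) · (qBinom Qc KK (K + suc s) · z ^ (K + suc s)) ⊕ q^ ((centralExponent k + suc s * suc s) * c) · (qBinom Qc KK (K ∸ suc s) · z ^ (K ∸ suc s))
          ≈⟨ ⊕-cong (·-congʳ _ (split (suc s * suc s))) (·-congʳ _ (split (suc s * suc s))) ⟩
            q^ (centralExponent k * c) · q^ (suc s * suc s * c) · (qBinom Qc KK (K + suc s) · z ^ (K + suc s)) ⊕ q^ (centralExponent k * c) · q^ (suc s * suc s * c) · (qBinom Qc KK (K ∸ suc s) · z ^ (K ∸ suc s))
          ≈⟨ solve 4 (λ A B X Y → A :* B :* X :+ A :* B :* Y := A :* (B :* (X :+ Y))) ≈refl (q^ (centralExponent k * c)) (q^ (suc s * suc s * c)) _ _ ⟩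
            q^ (centralExponent k * c) · (q^ (suc s * suc s * c) · (qBinom Qc KK (K + suc s) · z ^ (K + suc s) ⊕ qBinom Qc KK (K ∸ suc s) · z ^ (K ∸ suc s))) ∎
          where
            eqk : s + (k ∸ s) ≡ k
            eqk = ℕP.m+[n∸m]≡n s≤k
            xp : termExponent k (K + suc s) ≡ centralExponent k + suc s * suc s
            xp = subst (λ k → termExponent k (suc k + suc s) ≡ centralExponent k + suc s * suc s) eqk (termExponent-above s (k ∸ s))
            xm : termExponent k (K ∸ suc s) ≡ centralExponent k + suc s * suc s
            xm = subst (λ k → termExponent k (suc k ∸ suc s) ≡ centralExponent k + suc s * suc s) eqk (termExponent-below s (k ∸ s))

open JacobiTripleProduct

module GaussIdentity where
  open import Data.Nat using (_+_; _*_)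

  ∏-const : ∀ n x → ∏ n (λ _ → x) ≡ x ^ n
  ∏-const zero x = refl
  ∏-const (suc n) x = cong (_· x) (∏-const n x)

  sgn : ℕ → Series
  sgn n = (⊖ 𝟙) ^ n

  oddProd : ℕ → Series
  oddProd K = ∏ K (λ i → [1-q^ (suc (i + i)) ])

  signedSquares : ℕ → Series
  signedSquares K = ∑ K (λ s → sgn (suc s) · q^ (suc s * suc s))

  module _ {N : ℕ} {m : ℤ} where
    open Reasoning {N} {m}

    sgn·sgn≈𝟙 : ∀ n → sgn n · sgn n ≈ 𝟙
    sgn·sgn≈𝟙 zero = solve 0 (con (+ 1) :* con (+ 1) := con (+ 1)) ≈refl
    sgn·sgn≈𝟙 (suc n) = ≈trans (solve 2 (λ a b → (a :* (:- b)) :* (a :* (:- b)) := (a :* a) :* (b :* b)) ≈refl (sgn n) 𝟙)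
                   (≈trans (·-congʳ (𝟙 · 𝟙) (sgn·sgn≈𝟙 n)) (solve 0 (con (+ 1) :* (con (+ 1) :* con (+ 1)) := con (+ 1)) ≈refl))

  module GaussFactors {N : ℕ} {m : ℤ} (k : ℕ) where
    open Reasoning {N} {m}
    K : ℕ
    K = suc k
    factor : ℕ → Series
    factor i = q^ (suc (k + k) * 1) ⊕ (q^ (2 * 1)) ^ i · ⊖ 𝟙

    factor-lower : ∀ i → i ≤ k → factor i ≈ ⊖ 𝟙 · q^ (2 * i + 0) · [1-q^ (suc ((k ∸ i) + (k ∸ i))) ]
    factor-lower i i≤k = begin
        q^ (suc (k + k) * 1) ⊕ (q^ (2 * 1)) ^ i · ⊖ 𝟙
      ≈⟨ ⊕-cong (≡⇒≈ (cong q^_ e1)) (·-congʳ (⊖ 𝟙) (q^-^ (2 * 1) i)) ⟩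
        q^ (2 * i + 0 + suc ((k ∸ i) + (k ∸ i))) ⊕ q^ (i * (2 * 1)) · ⊖ 𝟙
      ≈⟨ ⊕-cong (≈sym (q^·q^ _ _)) (·-congʳ (⊖ 𝟙) (≡⇒≈ (cong q^_ e2))) ⟩
        q^ (2 * i + 0) · q^ (suc ((k ∸ i) + (k ∸ i))) ⊕ q^ (2 * i + 0) · ⊖ 𝟙
      ≈⟨ solve 2 (λ P R → P :* R :+ P :* (:- con (+ 1)) := (:- con (+ 1)) :* P :* (con (+ 1) :- R)) ≈refl (q^ (2 * i + 0)) (q^ (suc ((k ∸ i) + (k ∸ i)))) ⟩
        ⊖ 𝟙 · q^ (2 * i + 0) · [1-q^ (suc ((k ∸ i) + (k ∸ i))) ] ∎
      where
        e1 : suc (k + k) * 1 ≡ 2 * i + 0 + suc ((k ∸ i) + (k ∸ i))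
        e1 = subst (λ k → suc (k + k) * 1 ≡ 2 * i + 0 + suc ((k ∸ i) + (k ∸ i))) (ℕP.m+[n∸m]≡n i≤k)
               (trans (arith i (k ∸ i)) (cong (λ t → 2 * i + 0 + suc (t + t)) (sym (ℕP.m+n∸m≡n i (k ∸ i)))))
          where arith : ∀ i r → suc ((i + r) + (i + r)) * 1 ≡ 2 * i + 0 + suc (r + r)
                arith = NS.solve-∀
        e2 : i * (2 * 1) ≡ 2 * i + 0
        e2 = arith i where arith : ∀ i → i * (2 * 1) ≡ 2 * i + 0
                           arith = NS.solve-∀

    factor-upper : ∀ i → factor (K + i) ≈ q^ (0 * i + suc (k + k) * 1) · [1-q^ (suc (i + i)) ]
    factor-upper i = begin
        q^ (suc (k + k) * 1) ⊕ (q^ (2 * 1)) ^ (K + i) · ⊖ 𝟙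
      ≈⟨ ⊕-cong (≡⇒≈ (cong q^_ (sym (ar0 k i)))) (·-congʳ (⊖ 𝟙) (≈trans (q^-^ (2 * 1) (K + i)) (≈trans (≡⇒≈ (cong q^_ (arith k i))) (≈sym (q^·q^ _ _))))) ⟩
        q^ (0 * i + suc (k + k) * 1) ⊕ q^ (0 * i + suc (k + k) * 1) · q^ (suc (i + i)) · ⊖ 𝟙
      ≈⟨ solve 2 (λ A R → A :+ A :* R :* (:- con (+ 1)) := A :* (con (+ 1) :- R)) ≈refl (q^ (0 * i + suc (k + k) * 1)) (q^ (suc (i + i))) ⟩
        q^ (0 * i + suc (k + k) * 1) · [1-q^ (suc (i + i)) ] ∎
      where arith : ∀ k i → (suc k + i) * (2 * 1) ≡ 0 * i + suc (k + k) * 1 + suc (i + i)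
            arith = NS.solve-∀
            ar0 : ∀ k i → 0 * i + suc (k + k) * 1 ≡ suc (k + k) * 1
            ar0 = NS.solve-∀

    ∏factor : ∏ (K + K) factor ≈ sgn K · q^ (centralExponent k * 1) · oddProd K · oddProd K
    ∏factor = begin
        ∏ (K + K) factor
      ≈⟨ ∏-split K K factor ⟩
        ∏ K factor · ∏ K (λ i → factor (K + i))
      ≈⟨ ·-cong (∏-cong K (λ i i<K → factor-lower i (ℕP.≤-pred i<K))) (∏-cong K (λ i _ → factor-upper i)) ⟩
        ∏ K (λ i → ⊖ 𝟙 · q^ (2 * i + 0) · [1-q^ (suc ((k ∸ i) + (k ∸ i))) ]) · ∏ K (λ i → q^ (0 * i + suc (k + k) * 1) · [1-q^ (suc (i + i)) ])
      ≈⟨ ·-cong (≈trans (∏-· K _ _) (·-congʳ _ (∏-· K _ _))) (∏-· K _ _) ⟩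
        ∏ K (λ _ → ⊖ 𝟙) · ∏ K (λ i → q^ (2 * i + 0)) · ∏ K (λ i → [1-q^ (suc ((k ∸ i) + (k ∸ i))) ]) · (∏ K (λ i → q^ (0 * i + suc (k + k) * 1)) · oddProd K)
      ≈⟨ ·-cong (·-cong (·-cong (≡⇒≈ (∏-const K (⊖ 𝟙))) (∏-q^-linear 2 0 K)) (≈sym (∏-reverse K (λ i → [1-q^ (suc (i + i)) ])))) (·-congʳ (oddProd K) (∏-q^-linear 0 (suc (k + k) * 1) K)) ⟩
        sgn K · q^ (2 * tri K + 0 * K) · oddProd K · (q^ (0 * tri K + suc (k + k) * 1 * K) · oddProd K)
      ≈⟨ solve 4 (λ s A O B → s :* A :* O :* (B :* O) := s :* (A :* B) :* O :* O) ≈refl (sgn K) (q^ (2 * tri K + 0 * K)) (oddProd K) (q^ (0 * tri K + suc (k + k) * 1 * K)) ⟩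
        sgn K · (q^ (2 * tri K + 0 * K) · q^ (0 * tri K + suc (k + k) * 1 * K)) · oddProd K · oddProd K
      ≈⟨ ·-congʳ (oddProd K) (·-congʳ (oddProd K) (·-congˡ (sgn K) (≈trans (q^·q^ _ _) (≡⇒≈ (cong q^_ (arith (tri K) K k)))))) ⟩
        sgn K · q^ (centralExponent k * 1) · oddProd K · oddProd K ∎
      where arith : ∀ t K k → 2 * t + 0 * K + (0 * t + suc (k + k) * 1 * K) ≡ (t * 2 + K * suc (k + k)) * 1
            arith = NS.solve-∀

  suc≤square : ∀ s c → suc s ≤ suc s * suc s * suc c
  suc≤square s c = ℕP.≤-trans (ℕP.m≤m*n (suc s) (suc s)) (ℕP.m≤m*n (suc s * suc s) (suc c))

  module Gauss (k : ℕ) where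
    K KK : ℕ
    K = suc k
    KK = K + K
    Qc : Series
    Qc = q^ (2 * 1)
    signedExpansion : Series
    signedExpansion = qBinom Qc KK K · sgn K ⊕ ∑ K (λ s → q^ (suc s * suc s * 1) · (qBinom Qc KK (K + suc s) · sgn (K + suc s) ⊕ qBinom Qc KK (K ∸ suc s) · sgn (K ∸ suc s)))
    binomialExpansion : Series
    binomialExpansion = qBinom Qc KK K ⊕ ∑ K (λ s → q^ (suc s * suc s * 1) · sgn (suc s) · (qBinom Qc KK (K + suc s) ⊕ qBinom Qc KK (K ∸ suc s)))

    sgn·oddProd²≈signedExpansion : ∀ {N m} → CongUpTo N m (sgn K · oddProd K · oddProd K) signedExpansion
    sgn·oddProd²≈signedExpansion {N} {m} = q^·-cancel (centralExponent k * 1) _ _ (≈trans (solve 4 (λ M s O P → M :* (s :* O :* P) := s :* M :* O :* P) ≈refl (q^ (centralExponent k * 1)) (sgn K) (oddProd K) (oddProd K))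
                    (≈trans (≈sym (GaussFactors.∏factor k)) (FiniteJacobi.jacobi-triple-product 1 (⊖ 𝟙) k)))
      where open Reasoning {N ℕ.+ centralExponent k * 1} {m}

    sgn·signedPair : ∀ {N m} s → suc s ≤ K → CongUpTo N m
      (sgn K · (q^ (suc s * suc s * 1) · (qBinom Qc KK (K + suc s) · sgn (K + suc s) ⊕ qBinom Qc KK (K ∸ suc s) · sgn (K ∸ suc s))))
      (q^ (suc s * suc s * 1) · sgn (suc s) · (qBinom Qc KK (K + suc s) ⊕ qBinom Qc KK (K ∸ suc s)))
    sgn·signedPair {N} {m} s le = begin
        sgn K · (q^ q · (gp · sgn (K + suc s) ⊕ gm · sgn (K ∸ suc s)))
      ≈⟨ ·-congˡ (sgn K) (·-congˡ (q^ q) (⊕-cong (·-congˡ gp (^-+ (⊖ 𝟙) K (suc s))) ≈refl)) ⟩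
        sgn K · (q^ q · (gp · (sgn K · sgn (suc s)) ⊕ gm · sgn (K ∸ suc s)))
      ≈⟨ ·-congʳ _ (≈trans (≡⇒≈ (cong sgn (sym (ℕP.m∸n+n≡m le)))) (^-+ (⊖ 𝟙) (K ∸ suc s) (suc s))) ⟩
        sgn (K ∸ suc s) · sgn (suc s) · (q^ q · (gp · (sgn K · sgn (suc s)) ⊕ gm · sgn (K ∸ suc s)))
      ≈⟨ lem ⟩
        q^ q · sgn (suc s) · (gp ⊕ gm) ∎
      where
        open Reasoning {N} {m}
        q = suc s * suc s * 1
        gp = qBinom Qc KK (K + suc s)
        gm = qBinom Qc KK (K ∸ suc s)
        a = sgn (K ∸ suc s)
        b = sgn (suc s)
        lem : a · b · (q^ q · (gp · (sgn K · b) ⊕ gm · a)) ≈ q^ q · b · (gp ⊕ gm)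
        lem = begin
            a · b · (q^ q · (gp · (sgn K · b) ⊕ gm · a))
          ≈⟨ solve 6 (λ a b M gp sK gm → a :* b :* (M :* (gp :* (sK :* b) :+ gm :* a))
                        := M :* b :* (gp :* ((a :* b) :* sK) :+ gm :* (a :* a))) ≈refl a b (q^ q) gp (sgn K) gm ⟩
            q^ q · b · (gp · ((a · b) · sgn K) ⊕ gm · (a · a))
          ≈⟨ ·-congˡ (q^ q · b) (⊕-cong (·-congˡ gp (≈trans (·-congʳ (sgn K) (≈trans (≈sym (^-+ (⊖ 𝟙) (K ∸ suc s) (suc s))) (≡⇒≈ (cong sgn (ℕP.m∸n+n≡m le))))) (sgn·sgn≈𝟙 K)))
                                  (·-congˡ gm (sgn·sgn≈𝟙 (K ∸ suc s)))) ⟩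
            q^ q · b · (gp · 𝟙 ⊕ gm · 𝟙)
          ≈⟨ ·-congˡ (q^ q · b) (⊕-cong (≗⇒≈ (·-identityʳ gp)) (≗⇒≈ (·-identityʳ gm))) ⟩
            q^ q · b · (gp ⊕ gm) ∎

    oddProd²≈binomialExpansion : ∀ {N m} → CongUpTo N m (oddProd K · oddProd K) binomialExpansion
    oddProd²≈binomialExpansion {N} {m} = begin
        oddProd K · oddProd K
      ≈⟨ solve 2 (λ O P → O :* P := con (+ 1) :* O :* P) ≈refl (oddProd K) (oddProd K) ⟩
        𝟙 · oddProd K · oddProd K
      ≈⟨ ·-congʳ (oddProd K) (·-congʳ (oddProd K) (≈sym (sgn·sgn≈𝟙 K))) ⟩
        sgn K · sgn K · oddProd K · oddProd K
      ≈⟨ solve 3 (λ s O P → s :* s :* O :* P := s :* (s :* O :* P)) ≈refl (sgn K) (oddProd K) (oddProd K) ⟩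
        sgn K · (sgn K · oddProd K · oddProd K)
      ≈⟨ ·-congˡ (sgn K) sgn·oddProd²≈signedExpansion ⟩
        sgn K · signedExpansion
      ≈⟨ ≗⇒≈ (·-distribˡ (sgn K) _ _) ⟩
        sgn K · (qBinom Qc KK K · sgn K) ⊕ sgn K · ∑ K _
      ≈⟨ ⊕-cong (≈trans (solve 2 (λ s g → s :* (g :* s) := g :* (s :* s)) ≈refl (sgn K) (qBinom Qc KK K)) (≈trans (·-congˡ _ (sgn·sgn≈𝟙 K)) (≗⇒≈ (·-identityʳ _)))) (∑-·ˡ K _ (sgn K)) ⟩
        qBinom Qc KK K ⊕ ∑ K _
      ≈⟨ ⊕-cong ≈refl (∑-cong K (λ s s<K → sgn·signedPair s s<K)) ⟩
        binomialExpansion ∎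
      where open Reasoning {N} {m}

    gauss-identity : ∀ {N m} M → N + N ≤ k → N ≤ M → CongUpTo N m (oddProd K · oddProd K · qPoch (q^ 2) M) (𝟙 ⊕ scalar (+ 2) · signedSquares K)
    gauss-identity {N} {m} M NN≤k N≤M = begin
        oddProd K · oddProd K · qM
      ≈⟨ ·-congʳ qM oddProd²≈binomialExpansion ⟩
        binomialExpansion · qM
      ≈⟨ ≗⇒≈ (·-distribʳ qM _ _) ⟩
        qBinom Qc KK K · qM ⊕ ∑ K _ · qM
      ≈⟨ ⊕-cong (qBinom·qPoch≈𝟙 2 (s≤s z≤n) K K M NK NK N≤M) (∑-·ʳ K _ qM) ⟩
        𝟙 ⊕ ∑ K (λ s → q^ (suc s * suc s * 1) · sgn (suc s) · (qBinom Qc KK (K + suc s) ⊕ qBinom Qc KK (K ∸ suc s)) · qM)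
      ≈⟨ ⊕-cong ≈refl (∑-cong K (λ s s<K → term s s<K)) ⟩
        𝟙 ⊕ ∑ K (λ s → scalar (+ 2) · (sgn (suc s) · q^ (suc s * suc s)))
      ≈⟨ ⊕-cong ≈refl (≈sym (∑-·ˡ K _ (scalar (+ 2)))) ⟩
        𝟙 ⊕ scalar (+ 2) · signedSquares K ∎
      where
        open Reasoning {N} {m}
        qM = qPoch (q^ 2) M
        NK : N ≤ K
        NK = ℕP.≤-trans (ℕP.m+n≤o⇒m≤o N NN≤k) (ℕP.n≤1+n k)
        term : ∀ s → suc s ≤ K → q^ (suc s * suc s * 1) · sgn (suc s) · (qBinom Qc KK (K + suc s) ⊕ qBinom Qc KK (K ∸ suc s)) · qM
                                ≈ scalar (+ 2) · (sgn (suc s) · q^ (suc s * suc s))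
        term s le = begin
            q^ q · sgn (suc s) · (gp ⊕ gm) · qM
          ≈⟨ solve 5 (λ M b gp gm Q → M :* b :* (gp :+ gm) :* Q := b :* (M :* (gp :* Q) :+ M :* (gm :* Q))) ≈refl (q^ q) (sgn (suc s)) gp gm qM ⟩
            sgn (suc s) · (q^ q · (gp · qM) ⊕ q^ q · (gm · qM))
          ≈⟨ ·-congˡ (sgn (suc s)) (⊕-cong (q^·qBinom-above 2 (s≤s z≤n) k s q M le (suc≤square s 0) NN≤k N≤M)
                                         (q^·qBinom-below 2 (s≤s z≤n) k s q M le (suc≤square s 0) NN≤k N≤M)) ⟩
            sgn (suc s) · (q^ q ⊕ q^ q)
          ≈⟨ ·-congˡ (sgn (suc s)) (⊕-cong (≡⇒≈ (cong q^_ (ℕP.*-identityʳ _))) (≡⇒≈ (cong q^_ (ℕP.*-identityʳ _)))) ⟩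
            sgn (suc s) · (q^ (suc s * suc s) ⊕ q^ (suc s * suc s))
          ≈⟨ solve 2 (λ b M → b :* (M :+ M) := con (+ 2) :* (b :* M)) ≈refl (sgn (suc s)) (q^ (suc s * suc s)) ⟩
            scalar (+ 2) · (sgn (suc s) · q^ (suc s * suc s)) ∎
          where
            q = suc s * suc s * 1
            gp = qBinom Qc KK (K + suc s)
            gm = qBinom Qc KK (K ∸ suc s)

open GaussIdentity

module TSeries where
  open import Data.Nat using (_+_; _*_)

  -- 2t(3t + 2) and 2t(3t − 2) for t = s + 1, so that tSeries is Σ_{t ∈ ℤ} q^(2t(3t+2)).
  exp⁺ : ℕ → ℕ
  exp⁺ s = suc s * (10 + 6 * s)

  exp⁻ : ℕ → ℕ
  exp⁻ s = suc s * (2 + 6 * s)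

  plusProd : ℕ → Series
  plusProd K = ∏ K (λ i → [1+q^ (12 * i + 2) ]) · ∏ K (λ i → [1+q^ (12 * i + 10) ])

  tSeries : ℕ → Series
  tSeries K = 𝟙 ⊕ ∑ K (λ s → q^ (exp⁺ s) ⊕ q^ (exp⁻ s))

  module TSeriesFactors {N : ℕ} {m : ℤ} (k : ℕ) where
    open Reasoning {N} {m}
    K : ℕ
    K = suc k
    factor : ℕ → Series
    factor i = q^ (suc (k + k) * 6) ⊕ (q^ (2 * 6)) ^ i · q^ 4

    factor-monomials : ∀ i → factor i ≈ q^ (suc (k + k) * 6) ⊕ q^ (i * 12 + 4)
    factor-monomials i = ⊕-cong ≈refl (≈trans (·-congʳ (q^ 4) (q^-^ (2 * 6) i)) (q^·q^ _ _))

    factor-lower : ∀ i → i ≤ k → factor i ≈ q^ (12 * i + 4) · [1+q^ (12 * (k ∸ i) + 2) ]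
    factor-lower i i≤k = begin
        factor i
      ≈⟨ factor-monomials i ⟩
        q^ (suc (k + k) * 6) ⊕ q^ (i * 12 + 4)
      ≈⟨ ⊕-cong (≈trans (≡⇒≈ (cong q^_ e1)) (≈sym (q^·q^ _ _))) (≡⇒≈ (cong q^_ (ar2 i))) ⟩
        q^ (12 * i + 4) · q^ (12 * (k ∸ i) + 2) ⊕ q^ (12 * i + 4)
      ≈⟨ solve 2 (λ P R → P :* R :+ P := P :* (con (+ 1) :+ R)) ≈refl (q^ (12 * i + 4)) (q^ (12 * (k ∸ i) + 2)) ⟩
        q^ (12 * i + 4) · [1+q^ (12 * (k ∸ i) + 2) ] ∎
      where
        e1 : suc (k + k) * 6 ≡ 12 * i + 4 + (12 * (k ∸ i) + 2)
        e1 = subst (λ k → suc (k + k) * 6 ≡ 12 * i + 4 + (12 * (k ∸ i) + 2)) (ℕP.m+[n∸m]≡n i≤k)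
               (trans (arith i (k ∸ i)) (cong (λ t → 12 * i + 4 + (12 * t + 2)) (sym (ℕP.m+n∸m≡n i (k ∸ i)))))
          where arith : ∀ i r → suc ((i + r) + (i + r)) * 6 ≡ 12 * i + 4 + (12 * r + 2)
                arith = NS.solve-∀
        ar2 : ∀ i → i * 12 + 4 ≡ 12 * i + 4
        ar2 = NS.solve-∀

    factor-upper : ∀ i → factor (K + i) ≈ q^ (0 * i + suc (k + k) * 6) · [1+q^ (12 * i + 10) ]
    factor-upper i = begin
        factor (K + i)
      ≈⟨ factor-monomials (K + i) ⟩
        q^ (suc (k + k) * 6) ⊕ q^ ((K + i) * 12 + 4)
      ≈⟨ ⊕-cong (≡⇒≈ (cong q^_ (sym (ar0 k i)))) (≈trans (≡⇒≈ (cong q^_ (arith k i))) (≈sym (q^·q^ _ _))) ⟩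
        q^ (0 * i + suc (k + k) * 6) ⊕ q^ (0 * i + suc (k + k) * 6) · q^ (12 * i + 10)
      ≈⟨ solve 2 (λ A R → A :+ A :* R := A :* (con (+ 1) :+ R)) ≈refl (q^ (0 * i + suc (k + k) * 6)) (q^ (12 * i + 10)) ⟩
        q^ (0 * i + suc (k + k) * 6) · [1+q^ (12 * i + 10) ] ∎
      where arith : ∀ k i → (suc k + i) * 12 + 4 ≡ 0 * i + suc (k + k) * 6 + (12 * i + 10)
            arith = NS.solve-∀
            ar0 : ∀ k i → 0 * i + suc (k + k) * 6 ≡ suc (k + k) * 6
            ar0 = NS.solve-∀

    ∏factor : ∏ (K + K) factor ≈ q^ (centralExponent k * 6 + K * 4) · plusProd K
    ∏factor = begin
        ∏ (K + K) factor
      ≈⟨ ∏-split K K factor ⟩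
        ∏ K factor · ∏ K (λ i → factor (K + i))
      ≈⟨ ·-cong (∏-cong K (λ i i<K → factor-lower i (ℕP.≤-pred i<K))) (∏-cong K (λ i _ → factor-upper i)) ⟩
        ∏ K (λ i → q^ (12 * i + 4) · [1+q^ (12 * (k ∸ i) + 2) ]) · ∏ K (λ i → q^ (0 * i + suc (k + k) * 6) · [1+q^ (12 * i + 10) ])
      ≈⟨ ·-cong (∏-· K _ _) (∏-· K _ _) ⟩
        ∏ K (λ i → q^ (12 * i + 4)) · ∏ K (λ i → [1+q^ (12 * (k ∸ i) + 2) ]) · (∏ K (λ i → q^ (0 * i + suc (k + k) * 6)) · ∏ K (λ i → [1+q^ (12 * i + 10) ]))
      ≈⟨ ·-cong (·-cong (∏-q^-linear 12 4 K) (≈sym (∏-reverse K (λ i → [1+q^ (12 * i + 2) ])))) (·-congʳ _ (∏-q^-linear 0 (suc (k + k) * 6) K)) ⟩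
        q^ (12 * tri K + 4 * K) · ∏ K (λ i → [1+q^ (12 * i + 2) ]) · (q^ (0 * tri K + suc (k + k) * 6 * K) · ∏ K (λ i → [1+q^ (12 * i + 10) ]))
      ≈⟨ solve 4 (λ A P B Q → A :* P :* (B :* Q) := (A :* B) :* (P :* Q)) ≈refl (q^ (12 * tri K + 4 * K)) (∏ K (λ i → [1+q^ (12 * i + 2) ])) (q^ (0 * tri K + suc (k + k) * 6 * K)) (∏ K (λ i → [1+q^ (12 * i + 10) ])) ⟩
        (q^ (12 * tri K + 4 * K) · q^ (0 * tri K + suc (k + k) * 6 * K)) · plusProd K
      ≈⟨ ·-congʳ (plusProd K) (≈trans (q^·q^ _ _) (≡⇒≈ (cong q^_ (arith (tri K) K k)))) ⟩
        q^ (centralExponent k * 6 + K * 4) · plusProd K ∎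
      where arith : ∀ t K k → 12 * t + 4 * K + (0 * t + suc (k + k) * 6 * K) ≡ (t * 2 + K * suc (k + k)) * 6 + K * 4
            arith = NS.solve-∀

  exp⁺-≥ : ∀ s → suc s ≤ exp⁺ s
  exp⁺-≥ s = ℕP.m≤m*n (suc s) (10 + 6 * s)

  exp⁻-≥ : ∀ s → suc s ≤ exp⁻ s
  exp⁻-≥ s = ℕP.m≤m*n (suc s) (2 + 6 * s)

  module TSeriesJacobi (k : ℕ) where
    K KK : ℕ
    K = suc k
    KK = K + K
    Qc : Series
    Qc = q^ (2 * 6)
    binomialExpansion : Series
    binomialExpansion = qBinom Qc KK K ⊕ ∑ K (λ s → qBinom Qc KK (K + suc s) · q^ (exp⁺ s) ⊕ qBinom Qc KK (K ∸ suc s) · q^ (exp⁻ s))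

    jacobi-rearranged : ∀ {N m} → CongUpTo N m (q^ (centralExponent k * 6) · (qBinom Qc KK K · (q^ 4) ^ K ⊕
                 ∑ K (λ s → q^ (suc s * suc s * 6) · (qBinom Qc KK (K + suc s) · (q^ 4) ^ (K + suc s) ⊕ qBinom Qc KK (K ∸ suc s) · (q^ 4) ^ (K ∸ suc s)))))
               (q^ (centralExponent k * 6 + K * 4) · binomialExpansion)
    jacobi-rearranged {N} {m} = begin
        q^ (centralExponent k * 6) · (qBinom Qc KK K · (q^ 4) ^ K ⊕ ∑ K _)
      ≈⟨ ·-congˡ (q^ (centralExponent k * 6)) (⊕-cong (≈trans (·-congˡ (qBinom Qc KK K) (q^-^ 4 K)) (≗⇒≈ (·-comm (qBinom Qc KK K) _))) (∑-cong K (λ s s<K → term s (ℕP.≤-pred s<K)))) ⟩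
        q^ (centralExponent k * 6) · (q^ (K * 4) · qBinom Qc KK K ⊕ ∑ K (λ s → q^ (K * 4) · (qBinom Qc KK (K + suc s) · q^ (exp⁺ s) ⊕ qBinom Qc KK (K ∸ suc s) · q^ (exp⁻ s))))
      ≈⟨ ·-congˡ (q^ (centralExponent k * 6)) (⊕-cong ≈refl (≈sym (∑-·ˡ K _ (q^ (K * 4))))) ⟩
        q^ (centralExponent k * 6) · (q^ (K * 4) · qBinom Qc KK K ⊕ q^ (K * 4) · ∑ K (λ s → qBinom Qc KK (K + suc s) · q^ (exp⁺ s) ⊕ qBinom Qc KK (K ∸ suc s) · q^ (exp⁻ s)))
      ≈⟨ solve 4 (λ A B g S → A :* (B :* g :+ B :* S) := (A :* B) :* (g :+ S)) ≈refl (q^ (centralExponent k * 6)) (q^ (K * 4)) (qBinom Qc KK K) _ ⟩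
        (q^ (centralExponent k * 6) · q^ (K * 4)) · binomialExpansion
      ≈⟨ ·-congʳ binomialExpansion (q^·q^ _ _) ⟩
        q^ (centralExponent k * 6 + K * 4) · binomialExpansion ∎
      where
        open Reasoning {N} {m}
        term : ∀ s → s ≤ k → q^ (suc s * suc s * 6) · (qBinom Qc KK (K + suc s) · (q^ 4) ^ (K + suc s) ⊕ qBinom Qc KK (K ∸ suc s) · (q^ 4) ^ (K ∸ suc s))
                            ≈ q^ (K * 4) · (qBinom Qc KK (K + suc s) · q^ (exp⁺ s) ⊕ qBinom Qc KK (K ∸ suc s) · q^ (exp⁻ s))
        term s s≤k = begin
            q^ q · (gp · (q^ 4) ^ (K + suc s) ⊕ gm · (q^ 4) ^ (K ∸ suc s))
          ≈⟨ ·-congˡ (q^ q) (⊕-cong (·-congˡ gp (q^-^ 4 (K + suc s))) (·-congˡ gm (q^-^ 4 (K ∸ suc s)))) ⟩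
            q^ q · (gp · q^ ((K + suc s) * 4) ⊕ gm · q^ ((K ∸ suc s) * 4))
          ≈⟨ solve 5 (λ M gp A gm B → M :* (gp :* A :+ gm :* B) := gp :* (M :* A) :+ gm :* (M :* B)) ≈refl (q^ q) gp (q^ ((K + suc s) * 4)) gm (q^ ((K ∸ suc s) * 4)) ⟩
            gp · (q^ q · q^ ((K + suc s) * 4)) ⊕ gm · (q^ q · q^ ((K ∸ suc s) * 4))
          ≈⟨ ⊕-cong (·-congˡ gp (≈trans (q^·q^ _ _) (≈trans (≡⇒≈ (cong q^_ (e+ s k))) (≈sym (q^·q^ _ _)))))
                (·-congˡ gm (≈trans (q^·q^ _ _) (≈trans (≡⇒≈ (cong q^_ e-)) (≈sym (q^·q^ _ _))))) ⟩
            gp · (q^ (K * 4) · q^ (exp⁺ s)) ⊕ gm · (q^ (K * 4) · q^ (exp⁻ s))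
          ≈⟨ solve 5 (λ gp A B gm C → gp :* (A :* B) :+ gm :* (A :* C) := A :* (gp :* B :+ gm :* C)) ≈refl gp (q^ (K * 4)) (q^ (exp⁺ s)) gm (q^ (exp⁻ s)) ⟩
            q^ (K * 4) · (gp · q^ (exp⁺ s) ⊕ gm · q^ (exp⁻ s)) ∎
          where
            q = suc s * suc s * 6
            gp = qBinom Qc KK (K + suc s)
            gm = qBinom Qc KK (K ∸ suc s)
            e+ : ∀ s k → suc s * suc s * 6 + (suc k + suc s) * 4 ≡ suc k * 4 + suc s * (10 + 6 * s)
            e+ = NS.solve-∀
            e- : suc s * suc s * 6 + (K ∸ suc s) * 4 ≡ K * 4 + exp⁻ s
            e- = subst (λ k → suc s * suc s * 6 + (suc k ∸ suc s) * 4 ≡ suc k * 4 + exp⁻ s) (ℕP.m+[n∸m]≡n s≤k)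
                   (trans (cong (λ t → suc s * suc s * 6 + t * 4) (ℕP.m+n∸m≡n s (k ∸ s))) (arith s (k ∸ s)))
              where arith : ∀ s r → suc s * suc s * 6 + r * 4 ≡ suc (s + r) * 4 + suc s * (2 + 6 * s)
                    arith = NS.solve-∀

    plusProd≈binomialExpansion : ∀ {N m} → CongUpTo N m (plusProd K) binomialExpansion
    plusProd≈binomialExpansion {N} {m} = q^·-cancel (centralExponent k * 6 + K * 4) _ _ (≈trans (≈sym (TSeriesFactors.∏factor k)) (≈trans (FiniteJacobi.jacobi-triple-product 6 (q^ 4) k) jacobi-rearranged))
      where open Reasoning {N ℕ.+ (centralExponent k * 6 + K * 4)} {m}

    tSeries-product : ∀ {N m} M → N + N ≤ k → N ≤ M → CongUpTo N m (plusProd K · qPoch (q^ 12) M) (tSeries K)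
    tSeries-product {N} {m} M NN≤k N≤M = begin
        plusProd K · qM
      ≈⟨ ·-congʳ qM plusProd≈binomialExpansion ⟩
        binomialExpansion · qM
      ≈⟨ ≗⇒≈ (·-distribʳ qM _ _) ⟩
        qBinom Qc KK K · qM ⊕ ∑ K _ · qM
      ≈⟨ ⊕-cong (qBinom·qPoch≈𝟙 12 (s≤s z≤n) K K M NK NK N≤M) (∑-·ʳ K _ qM) ⟩
        𝟙 ⊕ ∑ K (λ s → (qBinom Qc KK (K + suc s) · q^ (exp⁺ s) ⊕ qBinom Qc KK (K ∸ suc s) · q^ (exp⁻ s)) · qM)
      ≈⟨ ⊕-cong ≈refl (∑-cong K (λ s s<K → term s s<K)) ⟩
        tSeries K ∎
      where
        open Reasoning {N} {m}
        qM = qPoch (q^ 12) M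
        NK : N ≤ K
        NK = ℕP.≤-trans (ℕP.m+n≤o⇒m≤o N NN≤k) (ℕP.n≤1+n k)
        term : ∀ s → suc s ≤ K → (qBinom Qc KK (K + suc s) · q^ (exp⁺ s) ⊕ qBinom Qc KK (K ∸ suc s) · q^ (exp⁻ s)) · qM ≈ q^ (exp⁺ s) ⊕ q^ (exp⁻ s)
        term s le = begin
            (gp · q^ (exp⁺ s) ⊕ gm · q^ (exp⁻ s)) · qM
          ≈⟨ solve 5 (λ gp A gm B Q → (gp :* A :+ gm :* B) :* Q := A :* (gp :* Q) :+ B :* (gm :* Q)) ≈refl gp (q^ (exp⁺ s)) gm (q^ (exp⁻ s)) qM ⟩
            q^ (exp⁺ s) · (gp · qM) ⊕ q^ (exp⁻ s) · (gm · qM)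
          ≈⟨ ⊕-cong (q^·qBinom-above 12 (s≤s z≤n) k s (exp⁺ s) M le (exp⁺-≥ s) NN≤k N≤M)
                    (q^·qBinom-below 12 (s≤s z≤n) k s (exp⁻ s) M le (exp⁻-≥ s) NN≤k N≤M) ⟩
            q^ (exp⁺ s) ⊕ q^ (exp⁻ s) ∎
          where
            gp = qBinom Qc KK (K + suc s)
            gm = qBinom Qc KK (K ∸ suc s)

open TSeries

module ModTwo where
  open import Data.Nat using (_+_; _*_)
  open import Data.Integer.Divisibility.Signed using (_∣_; divides; ∣m∣n⇒∣m+n; ∣m⇒∣-m; ∣n⇒∣m*n; ∣m⇒∣m*n; 0∣⇒≡0; *-monoʳ-∣; ∣⇒∣ᵤ)

  euler : ℕ → ℕ → Series
  euler d M = ∏ M (λ i → [1-q^ (d * suc i) ])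

  euler-admissible : ∀ d → 1 ≤ d → Admissible (λ i → [1-q^ (d * suc i) ])
  euler-admissible (suc d) _ i = [1-q^]-admissible (suc d * suc i) i (ℕP.m≤m+n (suc i) (d * suc i))

  euler-constantTerm : ∀ d → 1 ≤ d → ∀ M → euler d M 0 ≡ + 1
  euler-constantTerm d 1≤d M = ∏-constantTerm M _ (λ i → admissible-constantTerm (euler-admissible d 1≤d i))

  euler-stable : ∀ {N m} d → 1 ≤ d → ∀ {M M'} → N ≤ M → N ≤ M' → CongUpTo N m (euler d M) (euler d M')
  euler-stable d 1≤d = ∏-stable₂ _ (euler-admissible d 1≤d)

  module Frobenius {N : ℕ} where
    open Reasoning {N} {+ 2}

    ⊖≈id : ∀ X → ⊖ X ≈ X
    ⊖≈id X = begin
        ⊖ X ≈⟨ solve 1 (λ X → :- X := X :+ (:- (con (+ 2) :* X)) :+ con (+ 0)) ≈refl X ⟩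
        X ⊕ ⊖ (scalar (+ 2) · X) ⊕ 𝟘 ≈⟨ ⊕-cong (⊕-cong ≈refl (⊖-cong (scalar-modulus·≈𝟘 (+ 2) X))) ≈refl ⟩
        X ⊕ ⊖ 𝟘 ⊕ 𝟘 ≈⟨ solve 1 (λ X → X :+ (:- con (+ 0)) :+ con (+ 0) := X) ≈refl X ⟩
        X ∎

    [1+q^]≈[1-q^] : ∀ d → [1+q^ d ] ≈ [1-q^ d ]
    [1+q^]≈[1-q^] d = ⊕-cong ≈refl (≈sym (⊖≈id (q^ d)))

    [1-q^]-frobenius : ∀ d → [1-q^ d ] · [1-q^ d ] ≈ [1-q^ (d + d) ]
    [1-q^]-frobenius d = begin
        [1-q^ d ] · [1-q^ d ]
      ≈⟨ solve 1 (λ x → (con (+ 1) :- x) :* (con (+ 1) :- x) := (con (+ 1) :- x :* x) :+ con (+ 2) :* (x :* x :- x)) ≈refl (q^ d) ⟩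
        (𝟙 ⊕ ⊖ (q^ d · q^ d)) ⊕ scalar (+ 2) · (q^ d · q^ d ⊕ ⊖ q^ d)
      ≈⟨ ⊕-cong (⊕-cong ≈refl (⊖-cong (q^·q^ d d))) (scalar-modulus·≈𝟘 (+ 2) _) ⟩
        [1-q^ (d + d) ] ⊕ 𝟘
      ≈⟨ ≗⇒≈ (⊕-identityʳ [1-q^ (d + d) ]) ⟩
        [1-q^ (d + d) ] ∎

    euler-frobenius : ∀ d M → euler d M · euler d M ≈ euler (d + d) M
    euler-frobenius d M = ≈trans (≈sym (∏-· M _ _)) (∏-cong M (λ i _ → ≈trans ([1-q^]-frobenius (d * suc i)) (≡⇒≈ (cong [1-q^_] (sym (ℕP.*-distribʳ-+ (suc i) d d))))))

  ∏-blocks : ∀ {N m} d L f → CongUpTo N m (∏ (d * L) f) (∏ L (λ i → ∏ d (λ r → f (d * i + r))))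
  ∏-blocks {N} {m} d zero f = ≡⇒≈ (cong (λ t → ∏ t f) (ℕP.*-zeroʳ d))
    where open Reasoning {N} {m}
  ∏-blocks {N} {m} d (suc L) f = begin
      ∏ (d * suc L) f
    ≈⟨ ≡⇒≈ (cong (λ t → ∏ t f) (trans (ℕP.*-suc d L) (ℕP.+-comm d (d * L)))) ⟩
      ∏ (d * L + d) f
    ≈⟨ ∏-split (d * L) d f ⟩
      ∏ (d * L) f · ∏ d (λ r → f (d * L + r))
    ≈⟨ ·-congʳ _ (∏-blocks d L f) ⟩
      ∏ L (λ i → ∏ d (λ r → f (d * i + r))) · ∏ d (λ r → f (d * L + r)) ∎
    where open Reasoning {N} {m}

  minusProd : ℕ → Series
  minusProd K = ∏ K (λ i → [1-q^ (12 * i + 2) ] · [1-q^ (12 * i + 10) ])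

  module Regroup {N : ℕ} {m : ℤ} (K : ℕ) where
    open Reasoning {N} {m}
    c : ℕ → ℕ → Series
    c i j = [1-q^ (12 * i + j) ]

    reindex : ∀ a e i r → [1-q^ (a * suc (e * i + r)) ] ≈ [1-q^ ((a * e) * i + a * suc r) ]
    reindex a e i r = ≡⇒≈ (cong [1-q^_] (idx a e i r))
      where idx : ∀ a e i r → a * suc (e * i + r) ≡ (a * e) * i + a * suc r
            idx = NS.solve-∀

    euler2-blocks : euler 2 (6 * K) ≈ ∏ K (λ i → 𝟙 · c i 2 · c i 4 · c i 6 · c i 8 · c i 10 · c i 12)
    euler2-blocks = ≈trans (∏-blocks 6 K _) (∏-cong K (λ i _ →
           ·-cong (·-cong (·-cong (·-cong (·-cong (·-cong ≈refl (reindex 2 6 i 0)) (reindex 2 6 i 1)) (reindex 2 6 i 2)) (reindex 2 6 i 3)) (reindex 2 6 i 4)) (reindex 2 6 i 5)))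
    euler4-blocks : euler 4 (3 * K) ≈ ∏ K (λ i → 𝟙 · c i 4 · c i 8 · c i 12)
    euler4-blocks = ≈trans (∏-blocks 3 K _) (∏-cong K (λ i _ → ·-cong (·-cong (·-cong ≈refl (reindex 4 3 i 0)) (reindex 4 3 i 1)) (reindex 4 3 i 2)))
    euler6-blocks : euler 6 (2 * K) ≈ ∏ K (λ i → 𝟙 · c i 6 · c i 12)
    euler6-blocks = ≈trans (∏-blocks 2 K _) (∏-cong K (λ i _ → ·-cong (·-cong ≈refl (reindex 6 2 i 0)) (reindex 6 2 i 1)))
    euler12-blocks : euler 12 K ≈ ∏ K (λ i → c i 12)
    euler12-blocks = ∏-cong K (λ i _ → ≡⇒≈ (cong [1-q^_] (arith i)))
      where arith : ∀ i → 12 * suc i ≡ 12 * i + 12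
            arith = NS.solve-∀

    -- Both sides are f₁₂² times ∏ (1 − qᵉ) over the even e, sorted by e mod 12.
    minusProd-regroup : minusProd K · euler 12 K · euler 4 (3 * K) · euler 6 (2 * K) ≈ euler 2 (6 * K) · euler 12 K · euler 12 K
    minusProd-regroup = begin
        minusProd K · euler 12 K · euler 4 (3 * K) · euler 6 (2 * K)
      ≈⟨ ·-cong (·-cong (·-congˡ (minusProd K) euler12-blocks) euler4-blocks) euler6-blocks ⟩
        minusProd K · ∏ K (λ i → c i 12) · ∏ K (λ i → 𝟙 · c i 4 · c i 8 · c i 12) · ∏ K (λ i → 𝟙 · c i 6 · c i 12)
      ≈⟨ ≈sym (≈trans (∏-· K _ _) (·-congʳ _ (≈trans (∏-· K _ _) (·-congʳ _ (∏-· K _ _))))) ⟩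
        ∏ K (λ i → c i 2 · c i 10 · c i 12 · (𝟙 · c i 4 · c i 8 · c i 12) · (𝟙 · c i 6 · c i 12))
      ≈⟨ ∏-cong K (λ i _ → solve 6 (λ a b d e g c' → a :* e :* g :* (con (+ 1) :* b :* d :* g) :* (con (+ 1) :* c' :* g)
                                           := con (+ 1) :* a :* b :* c' :* d :* e :* g :* g :* g) ≈refl (c i 2) (c i 4) (c i 8) (c i 10) (c i 12) (c i 6)) ⟩
        ∏ K (λ i → (𝟙 · c i 2 · c i 4 · c i 6 · c i 8 · c i 10 · c i 12) · c i 12 · c i 12)
      ≈⟨ ≈trans (∏-· K _ _) (·-congʳ _ (∏-· K _ _)) ⟩
        ∏ K (λ i → 𝟙 · c i 2 · c i 4 · c i 6 · c i 8 · c i 10 · c i 12) · ∏ K (λ i → c i 12) · ∏ K (λ i → c i 12)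
      ≈⟨ ≈sym (·-cong (·-cong euler2-blocks euler12-blocks) euler12-blocks) ⟩
        euler 2 (6 * K) · euler 12 K · euler 12 K ∎

  -- T f₄ f₆ ≡ f₂ f₁₂² by the triple product and regrouping; multiplying by f₂, Frobenius gives
  -- f₂² f₁₂² ≡ f₄ f₂₄ ≡ f₄ f₆⁴, and f₄ f₆ cancels.
  tSeries-mod2 : ∀ {N} k → N + N ≤ k → CongUpTo N (+ 2) (euler 2 (suc k) · tSeries (suc k)) (euler 6 (suc k) · euler 6 (suc k) · euler 6 (suc k))
  tSeries-mod2 {N} k NN≤k = ·-cancelʳ-unit unit (begin
      euler 2 K · tSeries K · (euler 4 K · euler 6 K)
    ≈⟨ solve 4 (λ a t b c → a :* t :* (b :* c) := a :* (t :* b :* c)) ≈refl (euler 2 K) (tSeries K) (euler 4 K) (euler 6 K) ⟩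
      euler 2 K · (tSeries K · euler 4 K · euler 6 K)
    ≈⟨ ·-congˡ (euler 2 K) A ⟩
      euler 2 K · (euler 2 K · euler 12 K · euler 12 K)
    ≈⟨ solve 2 (λ a b → a :* (a :* b :* b) := (a :* a) :* (b :* b)) ≈refl (euler 2 K) (euler 12 K) ⟩
      (euler 2 K · euler 2 K) · (euler 12 K · euler 12 K)
    ≈⟨ ·-cong (Frobenius.euler-frobenius 2 K) (Frobenius.euler-frobenius 12 K) ⟩
      euler 4 K · euler 24 K
    ≈⟨ ·-congˡ (euler 4 K) (≈sym (≈trans (·-cong (Frobenius.euler-frobenius 6 K) (Frobenius.euler-frobenius 6 K)) (Frobenius.euler-frobenius 12 K))) ⟩
      euler 4 K · ((euler 6 K · euler 6 K) · (euler 6 K · euler 6 K))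
    ≈⟨ solve 2 (λ a b → a :* ((b :* b) :* (b :* b)) := b :* b :* b :* (a :* b)) ≈refl (euler 4 K) (euler 6 K) ⟩
      euler 6 K · euler 6 K · euler 6 K · (euler 4 K · euler 6 K) ∎)
    where
      open Reasoning {N} {+ 2}
      K : ℕ
      K = suc k
      NK : N ≤ K
      NK = ℕP.≤-trans (ℕP.m+n≤o⇒m≤o N NN≤k) (ℕP.n≤1+n k)
      unit : (euler 4 K · euler 6 K) 0 ≡ + 1
      unit = trans (·-constantTerm (euler 4 K) (euler 6 K)) (cong₂ ℤ._*_ (euler-constantTerm 4 (s≤s z≤n) K) (euler-constantTerm 6 (s≤s z≤n) K))
      qPoch-q¹²≈euler12 : qPoch (q^ 12) K ≈ euler 12 K
      qPoch-q¹²≈euler12 = ∏-cong K (λ i _ → ⊕-cong ≈refl (⊖-cong (≈trans (q^-^ 12 (suc i)) (≡⇒≈ (cong q^_ (ℕP.*-comm (suc i) 12))))))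
      plusProd≈minusProd : plusProd K ≈ minusProd K
      plusProd≈minusProd = ≈trans (≈sym (∏-· K _ _)) (∏-cong K (λ i _ → ·-cong (Frobenius.[1+q^]≈[1-q^] _) (Frobenius.[1+q^]≈[1-q^] _)))
      tSeries≈minusProd·euler12 : tSeries K ≈ minusProd K · euler 12 K
      tSeries≈minusProd·euler12 = ≈trans (≈sym (TSeriesJacobi.tSeries-product k K NN≤k NK)) (·-cong plusProd≈minusProd qPoch-q¹²≈euler12)
      N≤multiple : ∀ a → N ≤ suc a * K
      N≤multiple a = ℕP.≤-trans NK (ℕP.m≤m+n K (a * K))
      A : tSeries K · euler 4 K · euler 6 K ≈ euler 2 K · euler 12 K · euler 12 K
      A = begin
          tSeries K · euler 4 K · euler 6 K
        ≈⟨ ·-cong (·-cong tSeries≈minusProd·euler12 (euler-stable 4 (s≤s z≤n) NK (ℕP.≤-trans (N≤multiple 2) (ℕP.≤-reflexive (ℕP.*-comm 3 K))))) (euler-stable 6 (s≤s z≤n) NK (ℕP.≤-trans (N≤multiple 1) (ℕP.≤-reflexive (ℕP.*-comm 2 K)))) ⟩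
          minusProd K · euler 12 K · euler 4 (K * 3) · euler 6 (K * 2)
        ≈⟨ ≡⇒≈ (cong₂ (λ u v → minusProd K · euler 12 K · euler 4 u · euler 6 v) (ℕP.*-comm K 3) (ℕP.*-comm K 2)) ⟩
          minusProd K · euler 12 K · euler 4 (3 * K) · euler 6 (2 * K)
        ≈⟨ Regroup.minusProd-regroup K ⟩
          euler 2 (6 * K) · euler 12 K · euler 12 K
        ≈⟨ ·-congʳ (euler 12 K) (·-congʳ (euler 12 K) (euler-stable 2 (s≤s z≤n) (N≤multiple 5) NK)) ⟩
          euler 2 K · euler 12 K · euler 12 K ∎

open ModTwo

module GeneratingFunction where
  open ND using (_∣_; _∣?_)
  open import Data.Nat using (_+_; _*_)

  prodTo≗∏ : ∀ n F (Gf : ℕ → Series) → (∀ i → Gf i ≗ F (suc i)) → prodTo n F ≗ ∏ n Gf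
  prodTo≗∏ zero F Gf e i = sym (𝟙≗one i)
  prodTo≗∏ (suc n) F Gf e i = sym (trans (·-coeff (∏ n Gf) (Gf n) i) (⊛-cong-≗ _ _ _ _ (λ j → sym (prodTo≗∏ n F Gf e j)) (e n) i))

  oneMinusQ≗ : ∀ d → 1 ≤ d → oneMinusQ d ≗ [1-q^ d ]
  oneMinusQ≗ d 1≤d zero = sym (trans (⊕-coeff 𝟙 (⊖ q^ d) 0) (cong (λ t → + 1 ℤ.+ t) (trans (⊖-coeff (q^ d) 0)
                             (cong -_ (q^-coeff-other d 0 (λ 0≡d → ℕP.<-irrefl 0≡d 1≤d))))))
  oneMinusQ≗ d 1≤d (suc j) with suc j ℕ.≟ d
  ... | yes e = sym (trans (⊕-coeff 𝟙 (⊖ q^ d) (suc j)) (cong (λ t → + 0 ℤ.+ t) (trans (⊖-coeff (q^ d) (suc j)) (cong -_ (trans (cong (q^ d) e) (q^-coeff-self d))))))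
  ... | no ne = sym (trans (⊕-coeff 𝟙 (⊖ q^ d) (suc j)) (cong (λ t → + 0 ℤ.+ t) (trans (⊖-coeff (q^ d) (suc j)) (cong -_ (q^-coeff-other d (suc j) ne)))))

  onePlusQ≗ : ∀ d → 1 ≤ d → onePlusQ d ≗ [1+q^ d ]
  onePlusQ≗ d 1≤d zero = sym (trans (⊕-coeff 𝟙 (q^ d) 0) (cong (λ t → + 1 ℤ.+ t) (q^-coeff-other d 0 (λ 0≡d → ℕP.<-irrefl 0≡d 1≤d))))
  onePlusQ≗ d 1≤d (suc j) with suc j ℕ.≟ d
  ... | yes e = sym (trans (⊕-coeff 𝟙 (q^ d) (suc j)) (cong (λ t → + 0 ℤ.+ t) (trans (cong (q^ d) e) (q^-coeff-self d))))
  ... | no ne = sym (trans (⊕-coeff 𝟙 (q^ d) (suc j)) (cong (λ t → + 0 ℤ.+ t) (q^-coeff-other d (suc j) ne)))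

  geomQ-∣ : ∀ d a → d ∣ a → geomQ d a ≡ + 1
  geomQ-∣ d a h with d ∣? a
  ... | yes _ = refl
  ... | no nh = ⊥-elim (nh h)

  geomQ-∤ : ∀ d a → ¬ d ∣ a → geomQ d a ≡ + 0
  geomQ-∤ d a h with d ∣? a
  ... | yes p = ⊥-elim (h p)
  ... | no _ = refl

  geomQ-cong : ∀ d a b → (d ∣ a → d ∣ b) → (d ∣ b → d ∣ a) → geomQ d a ≡ geomQ d b
  geomQ-cong d a b f g with d ∣? a | d ∣? b
  ... | yes _ | yes _ = refl
  ... | no _ | no _ = refl
  ... | yes p | no q = ⊥-elim (q (f p))
  ... | no p | yes q = ⊥-elim (p (g q))

  ndiv : ∀ d j → 0 < j → j < d → ¬ d ∣ j
  ndiv d (suc j) _ j<d h = ℕP.<-irrefl refl (ℕP.<-≤-trans j<d (ND.∣⇒≤ h))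

  geomQ-admissible : ∀ i → CongUpTo i (+ 0) (geomQ (suc i)) 𝟙
  geomQ-admissible i = ≡⇒exact fg
    where fg : ∀ j → j ≤ i → geomQ (suc i) j ≡ 𝟙 j
          fg zero _ = geomQ-∣ (suc i) 0 (ND.divides 0 refl)
          fg (suc j) sj≤i = geomQ-∤ (suc i) (suc j) (ndiv (suc i) (suc j) (s≤s z≤n) (s≤s sj≤i))

  geomQ·[1-q^]≈𝟙 : ∀ d → 1 ≤ d → ∀ {N m} → CongUpTo N m (geomQ d · [1-q^ d ]) 𝟙
  geomQ·[1-q^]≈𝟙 d 1≤d {N} {m} = ≈trans (solve 2 (λ g x → g :* (con (+ 1) :- x) := g :- x :* g) ≈refl (geomQ d) (q^ d)) (exact⇒CongUpTo (≡⇒exact pt))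
    where
      open Reasoning {N} {m}
      pt : ∀ i → i ≤ N → (geomQ d ⊕ ⊖ (q^ d · geomQ d)) i ≡ 𝟙 i
      pt i _ with d ℕ.≤? i
      ... | yes d≤i = trans (⊕-coeff (geomQ d) (⊖ (q^ d · geomQ d)) i) (trans (cong (λ v → geomQ d i ℤ.+ v) (trans (⊖-coeff (q^ d · geomQ d) i) (cong -_ (q^·-coeff-≥ d (geomQ d) i d≤i))))
                        (trans (cong (λ t → t ℤ.+ - geomQ d (i ∸ d)) (geomQ-cong d i (i ∸ d) (λ h → ND.∣m+n∣m⇒∣n (subst (d ∣_) (sym (ℕP.m+[n∸m]≡n d≤i)) h) ND.∣-refl)
                                                                                   (λ h → subst (d ∣_) (ℕP.m+[n∸m]≡n d≤i) (ND.∣m∣n⇒∣m+n ND.∣-refl h))))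
                           (trans (ℤP.+-inverseʳ (geomQ d (i ∸ d))) (sym (i>0 i d≤i)))))
        where i>0 : ∀ i → d ≤ i → 𝟙 i ≡ + 0
              i>0 zero d≤0 = ⊥-elim (ℕP.<-irrefl refl (ℕP.<-≤-trans 1≤d d≤0))
              i>0 (suc i) _ = refl
      ... | no d≰i = trans (⊕-coeff (geomQ d) (⊖ (q^ d · geomQ d)) i) (trans (cong (λ v → geomQ d i ℤ.+ v) (trans (⊖-coeff (q^ d · geomQ d) i) (cong -_ (q^·-coeff-< d (geomQ d) i (ℕP.≰⇒> d≰i)))))
                       (trans (ℤP.+-identityʳ _) (z i (ℕP.≰⇒> d≰i))))
        where z : ∀ i → i < d → geomQ d i ≡ 𝟙 i
              z zero _ = geomQ-∣ d 0 (ND.divides 0 refl)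
              z (suc i) si<d = geomQ-∤ d (suc i) (ndiv d (suc i) (s≤s z≤n) si<d)

  plusEuler : ℕ → Series
  plusEuler M = ∏ M (λ i → [1+q^ (suc i) ])

  geomProd : ℕ → Series
  geomProd M = ∏ M (λ i → geomQ (suc i))

  rbarProd : ℕ → Series
  rbarProd M = ∏ M (λ i → [1-q^ (6 * suc i) ] · [1+q^ (suc i) ] · geomQ (suc i))

  module RbarProduct {N : ℕ} {m : ℤ} where
    open Reasoning {N} {m}

    [1-q^1*i] : ∀ i → [1-q^ (1 * i) ] ≈ [1-q^ i ]
    [1-q^1*i] i = ≡⇒≈ (cong [1-q^_] (ℕP.*-identityˡ i))

    plusEuler·euler1≈euler2 : ∀ M → plusEuler M · euler 1 M ≈ euler 2 M
    plusEuler·euler1≈euler2 M = ≈trans (≈sym (∏-· M _ _)) (∏-cong M (λ i _ → begin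
        [1+q^ (suc i) ] · [1-q^ (1 * suc i) ] ≈⟨ ·-congˡ _ ([1-q^1*i] (suc i)) ⟩
        [1+q^ (suc i) ] · [1-q^ (suc i) ] ≈⟨ solve 1 (λ x → (con (+ 1) :+ x) :* (con (+ 1) :- x) := con (+ 1) :- x :* x) ≈refl (q^ (suc i)) ⟩
        𝟙 ⊕ ⊖ (q^ (suc i) · q^ (suc i)) ≈⟨ ⊕-cong ≈refl (⊖-cong (≈trans (q^·q^ _ _) (≡⇒≈ (cong q^_ (arith i))))) ⟩
        [1-q^ (2 * suc i) ] ∎))
      where arith : ∀ i → suc i + suc i ≡ 2 * suc i
            arith = NS.solve-∀

    𝟙^≈𝟙 : ∀ n → 𝟙 ^ n ≈ 𝟙
    𝟙^≈𝟙 zero = ≈refl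
    𝟙^≈𝟙 (suc n) = ≈trans (·-congʳ 𝟙 (𝟙^≈𝟙 n)) (≗⇒≈ (·-identityʳ 𝟙))

    geomProd·euler1≈𝟙 : ∀ M → geomProd M · euler 1 M ≈ 𝟙
    geomProd·euler1≈𝟙 M = ≈trans (≈sym (∏-· M _ _)) (≈trans (∏-cong M (λ i _ → ≈trans (·-congˡ _ ([1-q^1*i] (suc i))) (geomQ·[1-q^]≈𝟙 (suc i) (s≤s z≤n))))
              (≈trans (≡⇒≈ (∏-const M 𝟙)) (𝟙^≈𝟙 M)))

    euler1≈oddProd·euler2 : ∀ K → euler 1 (2 * K) ≈ oddProd K · euler 2 K
    euler1≈oddProd·euler2 K = ≈trans (∏-blocks 2 K _) (≈trans (∏-cong K (λ i _ → ≈trans (·-cong (·-cong ≈refl (≡⇒≈ (cong [1-q^_] (a1 i)))) (≡⇒≈ (cong [1-q^_] (a2 i))))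
                                                                       (solve 2 (λ x y → con (+ 1) :* x :* y := x :* y) ≈refl _ _)))
                 (∏-· K _ _))
      where a1 : ∀ i → 1 * suc (2 * i + 0) ≡ suc (i + i)
            a1 = NS.solve-∀
            a2 : ∀ i → 1 * suc (2 * i + 1) ≡ 2 * suc i
            a2 = NS.solve-∀

    qPoch-q²≈euler2 : ∀ M → qPoch (q^ 2) M ≈ euler 2 M
    qPoch-q²≈euler2 M = ∏-cong M (λ i _ → ⊕-cong ≈refl (⊖-cong (≈trans (q^-^ 2 (suc i)) (≡⇒≈ (cong q^_ (ℕP.*-comm (suc i) 2))))))

    plusEuler·geomProd·oddProd²·qPoch≈𝟙 : ∀ K M → N ≤ K → N ≤ M → plusEuler M · geomProd M · oddProd K · oddProd K · qPoch (q^ 2) M ≈ 𝟙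
    plusEuler·geomProd·oddProd²·qPoch≈𝟙 K M N≤K N≤M = begin
        plusEuler M · geomProd M · oddProd K · oddProd K · qPoch (q^ 2) M
      ≈⟨ ·-congˡ _ (qPoch-q²≈euler2 M) ⟩
        plusEuler M · geomProd M · oddProd K · oddProd K · euler 2 M
      ≈⟨ solve 5 (λ a b o p e → a :* b :* o :* p :* e := (a :* o) :* (b :* (p :* e))) ≈refl (plusEuler M) (geomProd M) (oddProd K) (oddProd K) (euler 2 M) ⟩
        (plusEuler M · oddProd K) · (geomProd M · (oddProd K · euler 2 M))
      ≈⟨ ·-cong plusEuler·oddProd≈𝟙 (·-congˡ (geomProd M) oddProd·euler2≈euler1) ⟩
        𝟙 · (geomProd M · euler 1 M)
      ≈⟨ ≈trans (≗⇒≈ (·-identityˡ _)) (geomProd·euler1≈𝟙 M) ⟩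
        𝟙 ∎
      where
        N≤2K : N ≤ 2 * K
        N≤2K = ℕP.≤-trans N≤K (ℕP.m≤m+n K (K + 0))
        oddProd·euler2≈euler1 : oddProd K · euler 2 M ≈ euler 1 M
        oddProd·euler2≈euler1 = ≈trans (·-congˡ (oddProd K) (euler-stable 2 (s≤s z≤n) N≤M N≤K)) (≈trans (≈sym (euler1≈oddProd·euler2 K)) (euler-stable 1 (s≤s z≤n) N≤2K N≤M))
        plusEuler·oddProd≈𝟙 : plusEuler M · oddProd K ≈ 𝟙
        plusEuler·oddProd≈𝟙 = ·-cancelʳ-unit (euler-constantTerm 2 (s≤s z≤n) M) (begin
            plusEuler M · oddProd K · euler 2 M ≈⟨ ≗⇒≈ (·-assoc (plusEuler M) (oddProd K) (euler 2 M)) ⟩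
            plusEuler M · (oddProd K · euler 2 M) ≈⟨ ·-congˡ (plusEuler M) oddProd·euler2≈euler1 ⟩
            plusEuler M · euler 1 M ≈⟨ plusEuler·euler1≈euler2 M ⟩
            euler 2 M ≈⟨ ≗⇒≈ (λ i → sym (·-identityˡ (euler 2 M) i)) ⟩
            𝟙 · euler 2 M ∎)

    rbarProd·theta≈euler : ∀ k M → N + N ≤ k → N ≤ M → rbarProd M · (𝟙 ⊕ scalar (+ 2) · signedSquares (suc k)) ≈ euler 6 M
    rbarProd·theta≈euler k M NN≤k N≤M = begin
        rbarProd M · (𝟙 ⊕ scalar (+ 2) · signedSquares (suc k))
      ≈⟨ ·-cong (≈trans (∏-· M _ _) (·-congʳ _ (∏-· M _ _))) (≈sym (Gauss.gauss-identity k M NN≤k N≤M)) ⟩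
        euler 6 M · plusEuler M · geomProd M · (oddProd (suc k) · oddProd (suc k) · qPoch (q^ 2) M)
      ≈⟨ solve 6 (λ e a b o p q → e :* a :* b :* (o :* p :* q) := e :* (a :* b :* o :* p :* q)) ≈refl (euler 6 M) (plusEuler M) (geomProd M) (oddProd (suc k)) (oddProd (suc k)) (qPoch (q^ 2) M) ⟩
        euler 6 M · (plusEuler M · geomProd M · oddProd (suc k) · oddProd (suc k) · qPoch (q^ 2) M)
      ≈⟨ ·-congˡ (euler 6 M) (plusEuler·geomProd·oddProd²·qPoch≈𝟙 (suc k) M (ℕP.≤-trans (ℕP.m+n≤o⇒m≤o N NN≤k) (ℕP.n≤1+n k)) N≤M) ⟩
        euler 6 M · 𝟙
      ≈⟨ ≗⇒≈ (·-identityʳ (euler 6 M)) ⟩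
        euler 6 M ∎

  prodTo-stable : ∀ F (Gf : ℕ → Series) → (∀ j → Gf j ≗ F (suc j)) → Admissible Gf → ∀ {N M m} → N ≤ M → CongUpTo N m (λ i → prodTo i F i) (∏ M Gf)
  prodTo-stable F Gf e ad {N} {M} {m} N≤M = exact⇒CongUpTo (≡⇒exact (λ i i≤N → trans (prodTo≗∏ i F Gf e i)
     (sym (exact⇒≡ (∏-stable Gf ad {i} {M} {+ 0} (ℕP.≤-trans i≤N N≤M)) i ℕP.≤-refl))))

  rbarFactor-admissible : Admissible (λ i → [1-q^ (6 * suc i) ] · [1+q^ (suc i) ] · geomQ (suc i))
  rbarFactor-admissible i = ≈trans (·-cong (·-cong ([1-q^]-admissible (6 * suc i) i (ℕP.m≤m+n (suc i) (5 * suc i)))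
                           ([1+q^]-admissible (suc i) i ℕP.≤-refl)) (geomQ-admissible i))
                    (solve 0 (con (+ 1) :* con (+ 1) :* con (+ 1) := con (+ 1)) ≈refl)
    where open Reasoning {i} {+ 0}

  Rbar*≈rbarProd : ∀ {N M m} → N ≤ M → CongUpTo N m (λ i → Rbar* 6 i) (rbarProd M)
  Rbar*≈rbarProd = prodTo-stable _ _ e rbarFactor-admissible
    where e : ∀ j → ([1-q^ (6 * suc j) ] · [1+q^ (suc j) ] · geomQ (suc j)) ≗ (oneMinusQ (6 * suc j) ⊛ onePlusQ (suc j) ⊛ geomQ (suc j))
          e j i = trans (·-coeff ([1-q^ (6 * suc j) ] · [1+q^ (suc j) ]) (geomQ (suc j)) i)
                    (⊛-cong-≗ ([1-q^ (6 * suc j) ] · [1+q^ (suc j) ]) (oneMinusQ (6 * suc j) ⊛ onePlusQ (suc j)) (geomQ (suc j)) (geomQ (suc j))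
                       (λ t → trans (·-coeff [1-q^ (6 * suc j) ] [1+q^ (suc j) ] t)
                                (⊛-cong-≗ [1-q^ (6 * suc j) ] (oneMinusQ (6 * suc j)) [1+q^ (suc j) ] (onePlusQ (suc j))
                                   (λ u → sym (oneMinusQ≗ (6 * suc j) (s≤s z≤n) u)) (λ u → sym (onePlusQ≗ (suc j) (s≤s z≤n) u)) t))
                       (λ _ → refl) i)

  f6≈euler : ∀ {N M m} → N ≤ M → CongUpTo N m (f 6) (euler 6 M)
  f6≈euler = prodTo-stable _ _ e (euler-admissible 6 (s≤s z≤n))
    where e : ∀ j → [1-q^ (6 * suc j) ] ≗ oneMinusQ (suc j * 6)
          e j i = trans (cong (λ t → [1-q^ t ] i) (ℕP.*-comm 6 (suc j))) (sym (oneMinusQ≗ (suc j * 6) (s≤s z≤n) i))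

  doubledSquares : ℕ → Series
  doubledSquares K = ∑ K (λ s → q^ (suc s * suc s + suc s * suc s))

  signedSquares²≈doubledSquares : ∀ {N} K → CongUpTo N (+ 2) (signedSquares K · signedSquares K) (doubledSquares K)
  signedSquares²≈doubledSquares {N} zero = solve 0 (con (+ 0) :* con (+ 0) := con (+ 0)) ≈refl
    where open Reasoning {N} {+ 2}
  signedSquares²≈doubledSquares {N} (suc K) = begin
      (signedSquares K ⊕ sgn (suc K) · x) · (signedSquares K ⊕ sgn (suc K) · x)
    ≈⟨ solve 3 (λ A b x → (A :+ b :* x) :* (A :+ b :* x) := A :* A :+ con (+ 2) :* (A :* b :* x) :+ (b :* b) :* (x :* x)) ≈refl (signedSquares K) (sgn (suc K)) x ⟩
      signedSquares K · signedSquares K ⊕ scalar (+ 2) · (signedSquares K · sgn (suc K) · x) ⊕ (sgn (suc K) · sgn (suc K)) · (x · x)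
    ≈⟨ ⊕-cong (⊕-cong (signedSquares²≈doubledSquares K) (scalar-modulus·≈𝟘 (+ 2) _)) (·-cong (sgn·sgn≈𝟙 (suc K)) (q^·q^ _ _)) ⟩
      doubledSquares K ⊕ 𝟘 ⊕ 𝟙 · q^ (suc K * suc K + suc K * suc K)
    ≈⟨ solve 2 (λ a b → a :+ con (+ 0) :+ con (+ 1) :* b := a :+ b) ≈refl (doubledSquares K) _ ⟩
      doubledSquares K ⊕ q^ (suc K * suc K + suc K * suc K) ∎
    where open Reasoning {N} {+ 2}
          x = q^ (suc K * suc K)

  sgnℤ : ℕ → ℤ
  sgnℤ zero = + 1
  sgnℤ (suc j) = - sgnℤ j

  sgn≗scalar : ∀ j → sgn j ≗ scalar (sgnℤ j)
  sgn≗scalar zero i = refl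
  sgn≗scalar (suc j) i = trans (·-cong-≗ (sgn≗scalar j) (λ _ → refl) i) (trans (scalar·-coeff (sgnℤ j) (⊖ 𝟙) i) (z i))
    where z : ∀ i → sgnℤ j ℤ.* (⊖ 𝟙) i ≡ scalar (- sgnℤ j) i
          z zero = trans (cong (sgnℤ j ℤ.*_) (⊖-coeff 𝟙 0)) (trans (ℤP.*-comm (sgnℤ j) (- + 1)) (ℤP.-1*i≡-i (sgnℤ j)))
          z (suc i) = trans (cong (sgnℤ j ℤ.*_) (⊖-coeff 𝟙 (suc i))) (ℤP.*-zeroʳ (sgnℤ j))

open GeneratingFunction

module Trisection where
  open import Data.Nat using (_+_; _*_)

  Dilation₃ : Series → Series → Set
  Dilation₃ A B = ∀ t → (A (3 * t) ≡ B t) × (A (3 * t + 1) ≡ + 0) × (A (3 * t + 2) ≡ + 0)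

  ·[1-q^]-coeff : ∀ A e i → (A · [1-q^ e ]) i ≡ A i ℤ.- (q^ e · A) i
  ·[1-q^]-coeff A e i = trans (exact⇒≡ {i} (solve 2 (λ A x → A :* (con (+ 1) :- x) := A :- x :* A) ≈refl A (q^ e)) i ℕP.≤-refl)
                  (trans (⊕-coeff A (⊖ (q^ e · A)) i) (cong (λ t → A i ℤ.+ t) (⊖-coeff (q^ e · A) i)))
    where open Reasoning {i} {+ 0}

  3*-∸ : ∀ n y a b → y ≤ n → b ≤ a → (3 * n + a) ∸ (3 * y + b) ≡ 3 * (n ∸ y) + (a ∸ b)
  3*-∸ n y a b y≤n b≤a = subst (λ n → (3 * n + a) ∸ (3 * y + b) ≡ 3 * (n ∸ y) + (a ∸ b)) (ℕP.m+[n∸m]≡n y≤n)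
     (trans (cong (_∸ (3 * y + b)) (arith y (n ∸ y) a b b≤a)) (trans (ℕP.m+n∸m≡n (3 * y + b) (3 * (n ∸ y) + (a ∸ b)))
       (cong (λ u → 3 * u + (a ∸ b)) (sym (ℕP.m+n∸m≡n y (n ∸ y))))))
    where arith : ∀ y u a b → b ≤ a → 3 * (y + u) + a ≡ 3 * y + b + (3 * u + (a ∸ b))
          arith y u a b b≤a = trans (cong (λ t → 3 * (y + u) + t) (sym (ℕP.m+[n∸m]≡n b≤a))) (arith' y u b (a ∸ b))
            where arith' : ∀ y u b c → 3 * (y + u) + (b + c) ≡ 3 * y + b + (3 * u + c)
                  arith' = NS.solve-∀

  3*-≤ : ∀ n y a b → y ≤ n → b ≤ a → 3 * y + b ≤ 3 * n + a
  3*-≤ n y a b y≤n b≤a = ℕP.+-mono-≤ (ℕP.*-monoʳ-≤ 3 y≤n) b≤a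

  3*-< : ∀ n y a b → n < y → a < 3 → 3 * n + a < 3 * y + b
  3*-< n y a b n<y a<3 = ℕP.≤-trans (ℕP.≤-trans (ℕP.≤-reflexive (sym (ℕP.+-suc (3 * n) a))) (ℕP.+-monoʳ-≤ (3 * n) a<3)) (ℕP.≤-trans (ℕP.≤-reflexive (arith n)) (ℕP.≤-trans (ℕP.*-monoʳ-≤ 3 n<y) (ℕP.m≤m+n (3 * y) b)))
    where arith : ∀ n → 3 * n + 3 ≡ 3 * suc n
          arith = NS.solve-∀

  q^·-coeff-3 : ∀ A y b t a → y ≤ t → b ≤ a → (q^ (3 * y + b) · A) (3 * t + a) ≡ A (3 * (t ∸ y) + (a ∸ b))
  q^·-coeff-3 A y b t a y≤t b≤a = trans (q^·-coeff-≥ (3 * y + b) A (3 * t + a) (3*-≤ t y a b y≤t b≤a)) (cong A (3*-∸ t y a b y≤t b≤a))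

  q^·-coeff-3-vanish : ∀ A y b t a → t < y → a < 3 → (q^ (3 * y + b) · A) (3 * t + a) ≡ + 0
  q^·-coeff-3-vanish A y b t a t<y a<3 = q^·-coeff-< (3 * y + b) A (3 * t + a) (3*-< t y a b t<y a<3)

  Dilation₃-𝟙 : Dilation₃ 𝟙 𝟙
  Dilation₃-𝟙 zero = refl , refl , refl
  Dilation₃-𝟙 (suc t) = trans (cong 𝟙 (e0 t)) refl , trans (cong 𝟙 (e1 t)) refl , trans (cong 𝟙 (e2 t)) refl
    where e0 : ∀ t → 3 * suc t ≡ suc (3 * t + 2)
          e0 = NS.solve-∀
          e1 : ∀ t → 3 * suc t + 1 ≡ suc (3 * t + 3)
          e1 = NS.solve-∀
          e2 : ∀ t → 3 * suc t + 2 ≡ suc (3 * t + 4)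
          e2 = NS.solve-∀

  Dilation₃-step : ∀ A B d → Dilation₃ A B → Dilation₃ (A · [1-q^ (3 * d + 0) ]) (B · [1-q^ d ])
  Dilation₃-step A B d h t with d ℕ.≤? t
  ... | yes d≤t = trans (·[1-q^]-coeff A _ _) (trans (cong₂ ℤ._-_ (proj₁ (h t)) (trans (cong (λ u → (q^ (3 * d + 0) · A) u) (sym (ℕP.+-identityʳ (3 * t)))) (trans (q^·-coeff-3 A d 0 t 0 d≤t z≤n) (trans (cong A (ℕP.+-identityʳ _)) (proj₁ (h (t ∸ d)))))))
                     (sym (trans (·[1-q^]-coeff B d t) (cong (λ u → B t ℤ.- u) (q^·-coeff-≥ d B t d≤t)))))
                , trans (·[1-q^]-coeff A _ _) (trans (cong₂ ℤ._-_ (proj₁ (proj₂ (h t))) (trans (q^·-coeff-3 A d 0 t 1 d≤t z≤n) (proj₁ (proj₂ (h (t ∸ d)))))) refl)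
                , trans (·[1-q^]-coeff A _ _) (trans (cong₂ ℤ._-_ (proj₂ (proj₂ (h t))) (trans (q^·-coeff-3 A d 0 t 2 d≤t z≤n) (proj₂ (proj₂ (h (t ∸ d)))))) refl)
  ... | no d≰t = trans (·[1-q^]-coeff A _ _) (trans (cong₂ ℤ._-_ (proj₁ (h t)) (trans (sym (cong (λ u → (q^ (3 * d + 0) · A) u) (ℕP.+-identityʳ (3 * t)))) (q^·-coeff-3-vanish A d 0 t 0 (ℕP.≰⇒> d≰t) (s≤s z≤n))))
                     (sym (trans (·[1-q^]-coeff B d t) (cong (λ u → B t ℤ.- u) (q^·-coeff-< d B t (ℕP.≰⇒> d≰t))))))
                , trans (·[1-q^]-coeff A _ _) (trans (cong₂ ℤ._-_ (proj₁ (proj₂ (h t))) (q^·-coeff-3-vanish A d 0 t 1 (ℕP.≰⇒> d≰t) (s≤s (s≤s z≤n)))) refl)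
                , trans (·[1-q^]-coeff A _ _) (trans (cong₂ ℤ._-_ (proj₂ (proj₂ (h t))) (q^·-coeff-3-vanish A d 0 t 2 (ℕP.≰⇒> d≰t) (s≤s (s≤s (s≤s z≤n))))) refl)

  Dilation₃-≗ : ∀ {A A' B} → A ≗ A' → Dilation₃ A B → Dilation₃ A' B
  Dilation₃-≗ {A} {A'} e h t = trans (sym (e _)) (proj₁ (h t)) , trans (sym (e _)) (proj₁ (proj₂ (h t))) , trans (sym (e _)) (proj₂ (proj₂ (h t)))

  Dilation₃-euler : ∀ M → Dilation₃ (euler 6 M) (euler 2 M)
  Dilation₃-euler zero = Dilation₃-𝟙
  Dilation₃-euler (suc M) = Dilation₃-≗ (·-cong-≗ (λ _ → refl) (λ i → cong (λ u → [1-q^ u ] i) (arith M))) (Dilation₃-step (euler 6 M) (euler 2 M) (2 * suc M) (Dilation₃-euler M))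
    where arith : ∀ M → 3 * (2 * suc M) + 0 ≡ 6 * suc M
          arith = NS.solve-∀

  ∑-coeff : ∀ K f i → ∑ K f i ≡ sumℤ K (λ s → f s i)
  ∑-coeff zero f i = 𝟘-coeff i
  ∑-coeff (suc K) f i = trans (⊕-coeff (∑ K f) (f K) i) (trans (cong (ℤ._+ f K i) (∑-coeff K f i)) (sym (sumℤ-snoc K (λ s → f s i))))

  sgn·-coeff : ∀ j X i → (sgn j · X) i ≡ sgnℤ j ℤ.* X i
  sgn·-coeff j X i = trans (·-cong-≗ (sgn≗scalar j) (λ _ → refl) i) (scalar·-coeff (sgnℤ j) X i)

  mod3-cases : ∀ j → Σ ℕ (λ a → (j ≡ 3 * a) ⊎ (j ≡ 3 * a + 1) ⊎ (j ≡ 3 * a + 2))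
  mod3-cases zero = 0 , inj₁ refl
  mod3-cases (suc j) with mod3-cases j
  ... | a , inj₁ e = a , inj₂ (inj₁ (trans (cong suc e) (sym (ℕP.+-comm (3 * a) 1))))
  ... | a , inj₂ (inj₁ e) = a , inj₂ (inj₂ (trans (cong suc e) (arith a)))
    where arith : ∀ a → suc (3 * a + 1) ≡ 3 * a + 2
          arith = NS.solve-∀
  ... | a , inj₂ (inj₂ e) = suc a , inj₁ (trans (cong suc e) (arith a))
    where arith : ∀ a → suc (3 * a + 2) ≡ 3 * suc a
          arith = NS.solve-∀

  square-mod3 : ∀ j → Σ ℕ (λ y → (j * j ≡ 3 * y + 0) ⊎ (j * j ≡ 3 * y + 1))
  square-mod3 j with mod3-cases j
  ... | a , inj₁ refl = 3 * a * a , inj₁ (arith a)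
    where arith : ∀ a → 3 * a * (3 * a) ≡ 3 * (3 * a * a) + 0
          arith = NS.solve-∀
  ... | a , inj₂ (inj₁ refl) = 3 * a * a + 2 * a , inj₂ (arith a)
    where arith : ∀ a → (3 * a + 1) * (3 * a + 1) ≡ 3 * (3 * a * a + 2 * a) + 1
          arith = NS.solve-∀
  ... | a , inj₂ (inj₂ refl) = 3 * a * a + 4 * a + 1 , inj₂ (arith a)
    where arith : ∀ a → (3 * a + 2) * (3 * a + 2) ≡ 3 * (3 * a * a + 4 * a + 1) + 1
          arith = NS.solve-∀

  module Coefficients (M : ℕ) where
    E6 E2 : Series
    E6 = euler 6 M
    E2 = euler 2 M
    dilation : Dilation₃ E6 E2
    dilation = Dilation₃-euler M

    q^[3y]·E6-at-3n+2 : ∀ y n → (q^ (3 * y + 0) · E6) (3 * n + 2) ≡ + 0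
    q^[3y]·E6-at-3n+2 y n with y ℕ.≤? n
    ... | yes y≤n = trans (q^·-coeff-3 E6 y 0 n 2 y≤n z≤n) (proj₂ (proj₂ (dilation (n ∸ y))))
    ... | no y≰n = q^·-coeff-3-vanish E6 y 0 n 2 (ℕP.≰⇒> y≰n) (s≤s (s≤s (s≤s z≤n)))

    q^[3y+1]·E6-at-3n+2 : ∀ y n → (q^ (3 * y + 1) · E6) (3 * n + 2) ≡ + 0
    q^[3y+1]·E6-at-3n+2 y n with y ℕ.≤? n
    ... | yes y≤n = trans (q^·-coeff-3 E6 y 1 n 2 y≤n (s≤s z≤n)) (proj₁ (proj₂ (dilation (n ∸ y))))
    ... | no y≰n = q^·-coeff-3-vanish E6 y 1 n 2 (ℕP.≰⇒> y≰n) (s≤s (s≤s (s≤s z≤n)))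

    q^[3y+2]·E6-at-3n+2 : ∀ y n → (q^ (3 * y + 2) · E6) (3 * n + 2) ≡ (q^ y · E2) n
    q^[3y+2]·E6-at-3n+2 y n with y ℕ.≤? n
    ... | yes y≤n = trans (q^·-coeff-3 E6 y 2 n 2 y≤n (s≤s (s≤s z≤n))) (trans (cong E6 (ℕP.+-identityʳ _)) (trans (proj₁ (dilation (n ∸ y))) (sym (q^·-coeff-≥ y E2 n y≤n))))
    ... | no y≰n = trans (q^·-coeff-3-vanish E6 y 2 n 2 (ℕP.≰⇒> y≰n) (s≤s (s≤s (s≤s z≤n)))) (sym (q^·-coeff-< y E2 n (ℕP.≰⇒> y≰n)))

    q^[j²]·E6-at-3n+2 : ∀ j n → (q^ (j * j) · E6) (3 * n + 2) ≡ + 0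
    q^[j²]·E6-at-3n+2 j n with square-mod3 j
    ... | y , inj₁ e = trans (cong (λ u → (q^ u · E6) (3 * n + 2)) e) (q^[3y]·E6-at-3n+2 y n)
    ... | y , inj₂ e = trans (cong (λ u → (q^ u · E6) (3 * n + 2)) e) (q^[3y+1]·E6-at-3n+2 y n)

    euler6-at-3n+2 : ∀ n → E6 (3 * n + 2) ≡ + 0
    euler6-at-3n+2 n = proj₂ (proj₂ (dilation n))

    euler6·signedSquares-at-3n+2 : ∀ K n → (E6 · signedSquares K) (3 * n + 2) ≡ + 0
    euler6·signedSquares-at-3n+2 K n = trans (exact⇒≡ r (3 * n + 2) ℕP.≤-refl) (trans (∑-coeff K _ (3 * n + 2))
                  (sumℤ-zero K _ (λ s _ → trans (sgn·-coeff (suc s) _ (3 * n + 2)) (trans (cong (sgnℤ (suc s) ℤ.*_) (q^[j²]·E6-at-3n+2 (suc s) n)) (ℤP.*-zeroʳ (sgnℤ (suc s)))))))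
      where
        r : CongUpTo (3 * n + 2) (+ 0) (E6 · signedSquares K) (∑ K (λ s → sgn (suc s) · (q^ (suc s * suc s) · E6)))
        r = ≈trans (∑-·ˡ K _ E6) (∑-cong K (λ s _ → solve 3 (λ a b c → a :* (b :* c) := b :* (c :* a)) ≈refl E6 (sgn (suc s)) (q^ (suc s * suc s))))
          where open Reasoning {3 * n + 2} {+ 0}

  ∑-fold-by-3 : ∀ {N m} K' h → CongUpTo N m (∑ (suc (3 * K')) h) (h 0 ⊕ ∑ K' (λ t → h (3 * t + 1) ⊕ h (3 * t + 2) ⊕ h (3 * t + 3)))
  ∑-fold-by-3 {N} {m} zero h = solve 1 (λ a → con (+ 0) :+ a := a :+ con (+ 0)) ≈refl (h 0)
    where open Reasoning {N} {m}
  ∑-fold-by-3 {N} {m} (suc K') h = begin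
      ∑ (suc (3 * suc K')) h
    ≈⟨ ≡⇒≈ (cong (λ u → ∑ (suc u) h) (arith K')) ⟩
      ∑ (suc (3 * K')) h ⊕ h (suc (3 * K')) ⊕ h (suc (suc (3 * K'))) ⊕ h (suc (suc (suc (3 * K'))))
    ≈⟨ ⊕-cong (⊕-cong (⊕-cong (∑-fold-by-3 K' h) (≡⇒≈ (cong h (a1 K')))) (≡⇒≈ (cong h (a2 K')))) (≡⇒≈ (cong h (a3 K'))) ⟩
      h 0 ⊕ ∑ K' F ⊕ h (3 * K' + 1) ⊕ h (3 * K' + 2) ⊕ h (3 * K' + 3)
    ≈⟨ solve 5 (λ a s x y z → a :+ s :+ x :+ y :+ z := a :+ (s :+ (x :+ y :+ z))) ≈refl (h 0) (∑ K' F) _ _ _ ⟩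
      h 0 ⊕ ∑ (suc K') F ∎
    where
      open Reasoning {N} {m}
      F : ℕ → Series
      F t = h (3 * t + 1) ⊕ h (3 * t + 2) ⊕ h (3 * t + 3)
      arith : ∀ K → 3 * suc K ≡ suc (suc (suc (3 * K)))
      arith = NS.solve-∀
      a1 : ∀ K → suc (3 * K) ≡ 3 * K + 1
      a1 = NS.solve-∀
      a2 : ∀ K → suc (suc (3 * K)) ≡ 3 * K + 2
      a2 = NS.solve-∀
      a3 : ∀ K → suc (suc (suc (3 * K))) ≡ 3 * K + 3
      a3 = NS.solve-∀

  module DoubledSquareCoefficients (M : ℕ) where
    open Coefficients M
    q^doubledSquare : ℕ → Series
    q^doubledSquare k = q^ (suc k * suc k + suc k * suc k)

    euler6·doubledSquares-at-3n+2 : ∀ n K' → (E6 · doubledSquares (suc (3 * K'))) (3 * n + 2) ≡ (E2 · tSeries K') n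
    euler6·doubledSquares-at-3n+2 n K' = trans (exact⇒≡ lhs-split (3 * n + 2) ℕP.≤-refl) (trans (⊕-coeff _ _ (3 * n + 2))
        (trans (cong₂ ℤ._+_ (trans (·-comm E6 (q^doubledSquare 0) _) (trans (q^[3y+2]·E6-at-3n+2 0 n) (q^·-coeff-≥ 0 E2 n z≤n)))
                              (trans (∑-coeff K' _ (3 * n + 2)) (sumℤ-cong K' (λ t _ → residues t))))
           (sym (trans (exact⇒≡ rhs-split n ℕP.≤-refl) (trans (⊕-coeff _ _ n) (cong (λ u → E2 n ℤ.+ u) (∑-coeff K' _ n)))))))
      where
        N = 3 * n + 2
        lhs-split : CongUpTo N (+ 0) (E6 · doubledSquares (suc (3 * K'))) (E6 · q^doubledSquare 0 ⊕ ∑ K' (λ t → E6 · q^doubledSquare (3 * t + 1) ⊕ E6 · q^doubledSquare (3 * t + 2) ⊕ E6 · q^doubledSquare (3 * t + 3)))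
        lhs-split = ≈trans (·-congˡ E6 (∑-fold-by-3 K' q^doubledSquare)) (≈trans (≗⇒≈ (·-distribˡ E6 _ _)) (⊕-cong ≈refl (≈trans (∑-·ˡ K' _ E6)
               (∑-cong K' (λ t _ → solve 4 (λ a x y z → a :* (x :+ y :+ z) := a :* x :+ a :* y :+ a :* z) ≈refl E6 _ _ _)))))
          where open Reasoning {N} {+ 0}
        rhs-split : CongUpTo n (+ 0) (E2 · tSeries K') (E2 ⊕ ∑ K' (λ t → E2 · q^ (exp⁺ t) ⊕ E2 · q^ (exp⁻ t)))
        rhs-split = ≈trans (≗⇒≈ (·-distribˡ E2 _ _)) (⊕-cong (≗⇒≈ (·-identityʳ E2)) (≈trans (∑-·ˡ K' _ E2) (∑-cong K' (λ t _ → ≗⇒≈ (·-distribˡ E2 _ _)))))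
          where open Reasoning {n} {+ 0}
        -- For s = 3t + 2 and s = 3t + 4, 2s² = 3 · 2(t+1)(3t + 3 ∓ 2) + 2, while for 3 ∣ s, 2s² misses 3n + 2.
        square₁ : ∀ t → suc (3 * t + 1) * suc (3 * t + 1) + suc (3 * t + 1) * suc (3 * t + 1) ≡ 3 * exp⁻ t + 2
        square₁ t = arith t where arith : ∀ t → suc (3 * t + 1) * suc (3 * t + 1) + suc (3 * t + 1) * suc (3 * t + 1) ≡ 3 * (suc t * (2 + 6 * t)) + 2
                                  arith = NS.solve-∀
        square₂ : ∀ t → suc (3 * t + 2) * suc (3 * t + 2) + suc (3 * t + 2) * suc (3 * t + 2) ≡ 3 * (6 * suc t * suc t) + 0
        square₂ = NS.solve-∀
        square₃ : ∀ t → suc (3 * t + 3) * suc (3 * t + 3) + suc (3 * t + 3) * suc (3 * t + 3) ≡ 3 * exp⁺ t + 2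
        square₃ t = arith t where arith : ∀ t → suc (3 * t + 3) * suc (3 * t + 3) + suc (3 * t + 3) * suc (3 * t + 3) ≡ 3 * (suc t * (10 + 6 * t)) + 2
                                  arith = NS.solve-∀
        residues : ∀ t → (E6 · q^doubledSquare (3 * t + 1) ⊕ E6 · q^doubledSquare (3 * t + 2) ⊕ E6 · q^doubledSquare (3 * t + 3)) N ≡ (E2 · q^ (exp⁺ t) ⊕ E2 · q^ (exp⁻ t)) n
        residues t = trans (⊕-coeff _ _ N) (trans (cong₂ ℤ._+_ (⊕-coeff _ _ N) refl)
                   (trans (cong₂ ℤ._+_ (cong₂ ℤ._+_ (trans (·-comm E6 _ N) (trans (cong (λ u → (q^ u · E6) N) (square₁ t)) (q^[3y+2]·E6-at-3n+2 (exp⁻ t) n)))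
                                                       (trans (·-comm E6 _ N) (trans (cong (λ u → (q^ u · E6) N) (square₂ t)) (q^[3y]·E6-at-3n+2 (6 * suc t * suc t) n))))
                                         (trans (·-comm E6 _ N) (trans (cong (λ u → (q^ u · E6) N) (square₃ t)) (q^[3y+2]·E6-at-3n+2 (exp⁺ t) n))))
                     (trans (swap ((q^ (exp⁻ t) · E2) n) ((q^ (exp⁺ t) · E2) n))
                       (sym (trans (⊕-coeff _ _ n) (cong₂ ℤ._+_ (·-comm E2 (q^ (exp⁺ t)) n) (·-comm E2 (q^ (exp⁻ t)) n)))))))
          where swap : ∀ a b → a ℤ.+ + 0 ℤ.+ b ≡ b ℤ.+ a
                swap a b = trans (cong (ℤ._+ b) (ℤP.+-identityʳ a)) (ℤP.+-comm a b)

open Trisection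

module Conclusion where
  open import Data.Integer using (_+_; _*_; _-_)
  open import Data.Integer.Divisibility.Signed using (_∣_; ∣m∣n⇒∣m+n; *-monoʳ-∣)

  4·-mod8 : ∀ {N A B} → CongUpTo N (+ 2) A B → CongUpTo N (+ 8) (scalar (+ 4) · A) (scalar (+ 4) · B)
  4·-mod8 {N} {A} {B} r = congUpTo λ i i≤N →
    ∣-respʳ-≡ (sym (trans (cong₂ _-_ (scalar·-coeff (+ 4) A i) (scalar·-coeff (+ 4) B i)) (distrib (A i) (B i))))
      (*-monoʳ-∣ (+ 4) (coeffCong r i i≤N))
    where distrib : ∀ a b → + 4 * a - + 4 * b ≡ + 4 * (a - b)
          distrib = solve-∀

  expansion : ℕ → ℕ → Series
  expansion M K = euler 6 M ⊕ ⊖ (scalar (+ 2) · (euler 6 M · signedSquares K)) ⊕ scalar (+ 4) · (euler 6 M · doubledSquares K)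

  -- R · (1 + 2S) = f₆ by Gauss, and (1 + 2S)(1 − 2S + 4S²) = 1 + 8S³.
  Rbar*≈expansion : ∀ {N} M k → N ≤ M → N ℕ.+ N ≤ k → CongUpTo N (+ 8) (λ i → Rbar* 6 i) (expansion M (suc k))
  Rbar*≈expansion {N} M k N≤M NN≤k = begin
      R
    ≈⟨ solve 2 (λ r s → r := r :* (con (+ 1) :+ con (+ 2) :* s) :* (con (+ 1) :- con (+ 2) :* s :+ con (+ 4) :* (s :* s))
                             :- con (+ 8) :* (r :* s :* s :* s)) ≈refl R S ⟩
      R · (𝟙 ⊕ scalar (+ 2) · S) · (𝟙 ⊕ ⊖ (scalar (+ 2) · S) ⊕ scalar (+ 4) · (S · S)) ⊕ ⊖ (scalar (+ 8) · (R · S · S · S))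
    ≈⟨ ⊕-cong (·-congʳ _ (≈trans (·-congʳ _ (Rbar*≈rbarProd N≤M)) (RbarProduct.rbarProd·theta≈euler k M NN≤k N≤M)))
              (⊖-cong (scalar-modulus·≈𝟘 (+ 8) _)) ⟩
      E6 · (𝟙 ⊕ ⊖ (scalar (+ 2) · S) ⊕ scalar (+ 4) · (S · S)) ⊕ ⊖ 𝟘
    ≈⟨ solve 2 (λ e s → e :* (con (+ 1) :- con (+ 2) :* s :+ con (+ 4) :* (s :* s)) :- con (+ 0)
                        := e :- con (+ 2) :* (e :* s) :+ con (+ 4) :* (e :* (s :* s))) ≈refl E6 S ⟩
      E6 ⊕ ⊖ (scalar (+ 2) · (E6 · S)) ⊕ scalar (+ 4) · (E6 · (S · S))
    ≈⟨ ⊕-cong ≈refl (4·-mod8 (·-cong CongUpTo-refl (signedSquares²≈doubledSquares (suc k)))) ⟩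
      expansion M (suc k) ∎
    where
      open Reasoning {N} {+ 8}
      R : Series
      R i = Rbar* 6 i
      S : Series
      S = signedSquares (suc k)
      E6 : Series
      E6 = euler 6 M

  expansion-at-3n+2 : ∀ M K n → expansion M (suc (3 ℕ.* K)) (3 ℕ.* n ℕ.+ 2) ≡ + 4 * (euler 2 M · tSeries K) n
  expansion-at-3n+2 M K n = trans (⊕-coeff _ _ N) (trans (cong₂ _+_ lowerTerms upperTerm) (ℤP.+-identityˡ _))
    where
      N : ℕ
      N = 3 ℕ.* n ℕ.+ 2
      lowerTerms : (euler 6 M ⊕ ⊖ (scalar (+ 2) · (euler 6 M · signedSquares (suc (3 ℕ.* K))))) N ≡ + 0
      lowerTerms = trans (⊕-coeff _ _ N) (cong₂ _+_ (Coefficients.euler6-at-3n+2 M n)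
        (trans (⊖-coeff _ N) (cong -_ (trans (scalar·-coeff (+ 2) _ N)
          (cong (+ 2 *_) (Coefficients.euler6·signedSquares-at-3n+2 M (suc (3 ℕ.* K)) n))))))
      upperTerm : (scalar (+ 4) · (euler 6 M · doubledSquares (suc (3 ℕ.* K)))) N ≡ + 4 * (euler 2 M · tSeries K) n
      upperTerm = trans (scalar·-coeff (+ 4) _ N) (cong (+ 4 *_) (DoubledSquareCoefficients.euler6·doubledSquares-at-3n+2 M n K))

  euler6³≡f6³ : ∀ {N} M → N ≤ M → ∀ n → n ≤ N → (euler 6 M · euler 6 M · euler 6 M) n ≡ f³ 6 n
  euler6³≡f6³ {N} M N≤M n n≤N = trans (sym (exact⇒≡ f6³≈euler6³ n n≤N))
    (trans (·-coeff (f 6 · f 6) (f 6) n) (⊛-cong-≗ (f 6 · f 6) (f 6 ⊛ f 6) (f 6) (f 6) (·-coeff (f 6) (f 6)) (λ _ → refl) n))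
    where
      open Reasoning {N} {+ 0}
      f6³≈euler6³ : f 6 · f 6 · f 6 ≈ euler 6 M · euler 6 M · euler 6 M
      f6³≈euler6³ = ·-cong (·-cong (f6≈euler N≤M) (f6≈euler N≤M)) (f6≈euler N≤M)

  -- A truncation order for which every approximation used at degree 3n + 2 is exact.
  cutoff : ℕ → ℕ
  cutoff n = suc ((3 ℕ.* n ℕ.+ 2) ℕ.+ (3 ℕ.* n ℕ.+ 2))

  Rbar*-at-3n+2 : ∀ n → (+ 8) ∣ (Rbar* 6 (3 ℕ.* n ℕ.+ 2) - + 4 * (euler 2 (cutoff n) · tSeries (cutoff n)) n)
  Rbar*-at-3n+2 n = ∣-respʳ-≡ (cong (λ t → Rbar* 6 N - t) (expansion-at-3n+2 K K n))
    (coeffCong (Rbar*≈expansion K (3 ℕ.* K) N≤K NN≤3K) N ℕP.≤-refl)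
    where
      N K : ℕ
      N = 3 ℕ.* n ℕ.+ 2
      K = cutoff n
      N≤K : N ≤ K
      N≤K = ℕP.≤-trans (ℕP.m≤m+n N N) (ℕP.n≤1+n (N ℕ.+ N))
      NN≤3K : N ℕ.+ N ≤ 3 ℕ.* K
      NN≤3K = ℕP.≤-trans (ℕP.n≤1+n (N ℕ.+ N)) (ℕP.m≤n*m K 3)

  tSeries≡f6³-mod2 : ∀ n → (+ 2) ∣ ((euler 2 (cutoff n) · tSeries (cutoff n)) n - f³ 6 n)
  tSeries≡f6³-mod2 n = ∣-respʳ-≡ (cong (λ t → (euler 2 K · tSeries K) n - t) (euler6³≡f6³ K ℕP.≤-refl n n≤K))
    (coeffCong (tSeries-mod2 {N} (N ℕ.+ N) ℕP.≤-refl) n n≤N)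
    where
      N K : ℕ
      N = 3 ℕ.* n ℕ.+ 2
      K = cutoff n
      n≤N : n ≤ N
      n≤N = ℕP.≤-trans (ℕP.m≤m+n n (n ℕ.+ (n ℕ.+ 0))) (ℕP.m≤m+n (3 ℕ.* n) 2)
      n≤K : n ≤ K
      n≤K = ℕP.≤-trans n≤N (ℕP.≤-trans (ℕP.m≤m+n N N) (ℕP.n≤1+n (N ℕ.+ N)))

  mod8-combine : ∀ {a b c} → (+ 8) ∣ (a - + 4 * b) → (+ 2) ∣ (b - c) → (+ 8) ∣ (a - + 4 * c)
  mod8-combine {a} {b} {c} d e = ∣-respʳ-≡ (telescope a b c) (∣m∣n⇒∣m+n d (*-monoʳ-∣ (+ 4) e))
    where telescope : ∀ a b c → a - + 4 * b + + 4 * (b - c) ≡ a - + 4 * c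
          telescope = solve-∀

  Rbar*-3n+2-mod8 : ∀ n → (+ 8) ∣ (Rbar* 6 (3 ℕ.* n ℕ.+ 2) - + 4 * f³ 6 n)
  Rbar*-3n+2-mod8 n = mod8-combine {Rbar* 6 (3 ℕ.* n ℕ.+ 2)} {(euler 2 K · tSeries K) n} {f³ 6 n} (Rbar*-at-3n+2 n) (tSeries≡f6³-mod2 n)
    where K : ℕ
          K = cutoff n

open Conclusion

open import Data.Nat using (ℕ)
open import Data.Integer using (_-_; _*_)
open import Data.Integer.Divisibility using (_∣_)
open import Data.Integer.Divisibility.Signed using (∣⇒∣ᵤ)

lemma3p5 : (n : ℕ) → (+ 8) ∣ (Rbar* 6 (3 Data.Nat.* n Data.Nat.+ 2) - (+ 4) * f³ 6 n)
lemma3p5 n = ∣⇒∣ᵤ (Rbar*-3n+2-mod8 n)
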